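{- Let $\mathbb{F}$ be a field and $\mathbb{F}'$ a field extension of $\mathbb{F}$. Let $A_1\in \mathbb{F}^{S_1\times S_2}$ be a $\{c,d\}$-fragile matrix, where $c\in S_1$ and $d\in S_2$, and let $A_2$ be obtained from $A_1$ by replacing the $(c,d)$-entry with an element of $\mathbb{F}'-\mathbb{F}$. Then $(S_1-\{c\})\cup \{d\}$ is a circuit-hyperplane of $M([I,A_1])$, and $M([I,A_2])$ is the matroid obtained from $M([I,A_1])$ by relaxing $(S_1-\{c\})\cup \{d\}$.
   Context: For a matrix $A\in\mathbb{F}^{S_1\times S_2}$ with $S_1,S_2$ disjoint finite sets, $[I,A]$ is $A$ with an $S_1\times S_1$ identity matrix appended (columns indexed by $S_1\cup S_2$), and $M([I,A])$ is its column matroid on $S_1\cup S_2$. For $Z\subseteq S_1\cup S_2$, $A[Z]$ denotes the submatrix $A[Z\cap S_1,Z\cap S_2]$ (an empty matrix has rank $0$). For a finite set $X$, $A$ is $X$-fragile if $S_1\cap S_2=\emptyset$, $X\subseteq S_1\cup S_2$, $A[X]=0$, and for every nonempty $Y\subseteq (S_1\cup S_2)-X$ we have $\operatorname{rank}(A[X\cup Y])>\operatorname{rank}(A[Y])$. Relaxing a circuit-hyperplane $H$ of a matroid means forming the matroid whose bases are the original bases together with $H$. -}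

module Defs where

open import Level using (Level; _⊔_)
open import Data.Nat using (ℕ; zero; suc; _<_)
open import Data.Fin using (Fin; zero; suc; _≟_)
open import Data.Bool using (Bool; true; false; T; _∨_; _∧_; not; if_then_else_)
open import Data.Sum using (_⊎_; inj₁; inj₂)
open import Data.Sum.Properties using (≡-dec)
open import Data.Product using (Σ; ∃; _×_; _,_)
open import Relation.Nullary using (¬_)
open import Relation.Nullary.Decidable using (⌊_⌋)
open import Relation.Binary.Definitions using (DecidableEquality)
open import Relation.Binary.PropositionalEquality using (_≡_)
open import Algebra.Bundles using (CommutativeRing)

record Field (c ℓ : Level) : Set (Level.suc (c ⊔ ℓ)) where
  field
    commutativeRing : CommutativeRing c ℓ
  open CommutativeRing commutativeRing public
  field
    0≉1     : ¬ (0# ≈ 1#)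
    inverse : ∀ x → ¬ (x ≈ 0#) → ∃ λ y → (x * y) ≈ 1#

Subset : ∀ {a} → Set a → Set a
Subset E = E → Bool

_∈_ : ∀ {a} {E : Set a} → E → Subset E → Set
e ∈ S = T (S e)

_∪_ : ∀ {a} {E : Set a} → Subset E → Subset E → Subset E
(S ∪ S') e = S e ∨ S' e

_≐_ : ∀ {a} {E : Set a} → Subset E → Subset E → Set a
S ≐ S' = ∀ e → S e ≡ S' e

_⊆_ : ∀ {a} {E : Set a} → Subset E → Subset E → Set a
S ⊆ S' = ∀ e → e ∈ S → e ∈ S'

count : ∀ {n} → Subset (Fin n) → ℕ
count {zero} S = 0
count {suc n} S = (if S zero then 1 else 0) Data.Nat.+ count (λ i → S (suc i))

module MatroidNotions {a p} {E : Set a} (_≟E_ : DecidableEquality E)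
                      (Indep : Subset E → Set p) where

  insert : E → Subset E → Subset E
  insert e S x = ⌊ x ≟E e ⌋ ∨ S x

  remove : E → Subset E → Subset E
  remove e S x = not ⌊ x ≟E e ⌋ ∧ S x

  IsBasis : Subset E → Set (a ⊔ p)
  IsBasis B = Indep B × (∀ e → ¬ (e ∈ B) → ¬ Indep (insert e B))

  Spanning : Subset E → Set (a ⊔ p)
  Spanning S = ∃ λ B → IsBasis B × (B ⊆ S)

  IsCircuit : Subset E → Set (a ⊔ p)
  IsCircuit C = ¬ Indep C × (∀ e → e ∈ C → Indep (remove e C))

  IsHyperplane : Subset E → Set (a ⊔ p)
  IsHyperplane H = ¬ Spanning H × (∀ e → ¬ (e ∈ H) → Spanning (insert e H))

  IsCircuitHyperplane : Subset E → Set (a ⊔ p)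
  IsCircuitHyperplane H = IsCircuit H × IsHyperplane H

IsRelaxation : ∀ {a p q} {E : Set a} (_≟E_ : DecidableEquality E)
               (Indep₁ : Subset E → Set p) (Indep₂ : Subset E → Set q) →
               Subset E → Set (a ⊔ p ⊔ q)
IsRelaxation _≟E_ Indep₁ Indep₂ H =
  ∀ B → (M₂.IsBasis B → (M₁.IsBasis B ⊎ B ≐ H))
      × ((M₁.IsBasis B ⊎ B ≐ H) → M₂.IsBasis B)
  where
  module M₁ = MatroidNotions _≟E_ Indep₁
  module M₂ = MatroidNotions _≟E_ Indep₂

-- Ground set S₁ ∪ S₂ with S₁ = Fin m (rows), S₂ = Fin n (columns), disjoint

Ground : ℕ → ℕ → Set
Ground m n = Fin m ⊎ Fin n

_≟G_ : ∀ {m n} → DecidableEquality (Ground m n)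
_≟G_ = ≡-dec _≟_ _≟_

hyp : ∀ {m n} → Fin m → Fin n → Subset (Ground m n)
hyp c d (inj₁ i) = not ⌊ i ≟ c ⌋
hyp c d (inj₂ j) = ⌊ j ≟ d ⌋

pair : ∀ {m n} → Fin m → Fin n → Subset (Ground m n)
pair c d (inj₁ i) = ⌊ i ≟ c ⌋
pair c d (inj₂ j) = ⌊ j ≟ d ⌋

module LinAlg {c ℓ} (F : Field c ℓ) where
  open Field F using (Carrier; _≈_; _+_; _*_; 0#; 1#)

  Matrix : ℕ → ℕ → Set c
  Matrix m n = Fin m → Fin n → Carrier

  ∑ : ∀ {n} → (Fin n → Carrier) → Carrier
  ∑ {zero} f = 0#
  ∑ {suc n} f = f zero + ∑ (λ i → f (suc i))

  ∑G : ∀ {m n} → (Ground m n → Carrier) → Carrier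
  ∑G f = ∑ (λ i → f (inj₁ i)) + ∑ (λ j → f (inj₂ j))

  -- column e of [I, A]
  col : ∀ {m n} → Matrix m n → Ground m n → Fin m → Carrier
  col A (inj₁ i) k = if ⌊ i ≟ k ⌋ then 1# else 0#
  col A (inj₂ j) k = A k j

  IndepIA : ∀ {m n} → Matrix m n → Subset (Ground m n) → Set (c ⊔ ℓ)
  IndepIA A S =
    (coef : Ground _ _ → Carrier) →
    (∀ e → ¬ (e ∈ S) → coef e ≈ 0#) →
    (∀ k → ∑G (λ e → coef e * col A e k) ≈ 0#) →
    ∀ e → e ∈ S → coef e ≈ 0#

  -- for the submatrix A[Z] = A[Z ∩ S₁, Z ∩ S₂]: the columns D (⊆ Z ∩ S₂),
  -- restricted to the rows Z ∩ S₁, are linearly independent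
  IndepColsSub : ∀ {m n} → Matrix m n → Subset (Ground m n) → Subset (Fin n) → Set (c ⊔ ℓ)
  IndepColsSub {m} {n} A Z D =
    (coef : Fin n → Carrier) →
    (∀ j → ¬ (j ∈ D) → coef j ≈ 0#) →
    (∀ i → inj₁ i ∈ Z → ∑ (λ j → coef j * A i j) ≈ 0#) →
    ∀ j → j ∈ D → coef j ≈ 0#

  RankAtLeast : ∀ {m n} → Matrix m n → Subset (Ground m n) → ℕ → Set (c ⊔ ℓ)
  RankAtLeast A Z k =
    ∃ λ D → (∀ j → j ∈ D → inj₂ j ∈ Z) × (count D ≡ k) × IndepColsSub A Z D

  HasRank : ∀ {m n} → Matrix m n → Subset (Ground m n) → ℕ → Set (c ⊔ ℓ)
  HasRank A Z r = RankAtLeast A Z r × ¬ RankAtLeast A Z (suc r)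

  Fragile : ∀ {m n} → Matrix m n → Subset (Ground m n) → Set (c ⊔ ℓ)
  Fragile {m} {n} A X =
    (∀ i j → inj₁ i ∈ X → inj₂ j ∈ X → A i j ≈ 0#) ×
    (∀ (Y : Subset (Ground m n)) → (∃ λ e → e ∈ Y) → (∀ e → e ∈ Y → ¬ (e ∈ X)) →
      ∀ r r' → HasRank A (X ∪ Y) r → HasRank A Y r' → r' < r)

replaceEntry : ∀ {a b} {K : Set a} {K' : Set b} {m n} → (K → K') →
               (Fin m → Fin n → K) → Fin m → Fin n → K' → Fin m → Fin n → K'
replaceEntry ι A c d x i j = if ⌊ i ≟ c ⌋ ∧ ⌊ j ≟ d ⌋ then x else ι (A i j)

-- The proof works with determinants.  This identifies M([I, A]): bases have m elements, and a
-- set is independent iff the determinant of its columns is nonzero.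
-- Fragility then yields (i) directly (column d and row c of A₁ have no zero
-- entries besides A₁ c d = 0) and an exchange argument for bases; for (ii),
-- multilinearity gives det A₂[B] = ι(det A₁[B]) + x ι(det A₁[B - d + c]),
-- which vanishes iff both determinants do, because x ∉ ι F.
module Submission where

open import Level using (_⊔_)
open import Data.Nat as ℕ using (ℕ; zero; suc; _<_; _≤_; s≤s; z≤n)
import Data.Nat.Properties as ℕP
open import Data.Fin as Fin using (Fin; zero; suc; _≟_; punchIn; punchOut; toℕ)
import Data.Fin.Properties as FinP
open import Data.Bool using (Bool; true; false; T; T?; _∨_; _∧_; not; if_then_else_)
import Data.Bool.Properties as BoolP
open import Data.Sum using (_⊎_; inj₁; inj₂)
import Data.Sum.Properties as SumP
open import Data.Product using (∃; _×_; _,_; proj₁; proj₂)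
open import Data.Maybe using (Maybe; just; nothing)
open import Data.Empty using (⊥; ⊥-elim)
open import Data.Unit using (⊤; tt)
open import Data.Vec.Functional using (insertAt; updateAt)
import Data.Vec.Functional.Properties as VecFP
open import Function using (case_of_)
open import Relation.Nullary using (¬_; yes; no; Dec)
open import Relation.Nullary.Decidable using (⌊_⌋; toWitness; fromWitness; decidable-stable)
open import Relation.Binary.PropositionalEquality as ≡ using (_≡_; _≢_)
open import Relation.Binary.Definitions using (DecidableEquality; tri<; tri≈; tri>)
open import Algebra.Bundles using (CommutativeRing; RawRing)
open import Algebra.Morphism.Structures using (IsRingHomomorphism)
open import Algebra.Solver.Ring.AlmostCommutativeRing using (fromCommutativeRing; _-Raw-AlmostCommutative⟶_)
import Algebra.Solver.Ring as RingSolverCore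
import Algebra.Properties.Semiring.Mult as SemiringMult
import Algebra.Properties.Ring as RingProperties
import Relation.Binary.Reasoning.Setoid as SetoidReasoning
open import Defs

-- The standard library's
-- solver needs a coefficient ring with a semi-decision procedure for
-- equality; we use formal differences (a , b) of naturals, read as the
-- integer a - b, interpreted in R by (a , b) ↦ a·1 - b·1.
module CommRingSolver {c ℓ} (CR : CommutativeRing c ℓ) where
  open CommutativeRing CR
  open SemiringMult semiring using (×-homo-+; ×1-homo-*; ×-homo-1) renaming (_×_ to _·1_)
  open RingProperties ring using (-‿distribˡ-*; -‿distribʳ-*; -‿involutive; -‿+-comm; -0#≈0#)
  open SetoidReasoning setoid

  Differences : RawRing _ _
  Differences = record
    { Carrier = ℕ × ℕ ; _≈_ = _≡_
    ; _+_ = λ { (a , b) (c , d) → (a ℕ.+ c , b ℕ.+ d) }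
    ; _*_ = λ { (a , b) (c , d) → (a ℕ.* c ℕ.+ b ℕ.* d , a ℕ.* d ℕ.+ b ℕ.* c) }
    ; -_ = λ { (a , b) → (b , a) }
    ; 0# = (0 , 0) ; 1# = (1 , 0) }

  ⟦_⟧ : ℕ × ℕ → Carrier
  ⟦ (a , b) ⟧ = a ·1 1# - b ·1 1#

  private
    sub-+-sub : ∀ x y z w → (x - y) + (z - w) ≈ (x + z) - (y + w)
    sub-+-sub x y z w = begin
      (x - y) + (z - w)   ≈⟨ +-assoc x (- y) (z - w) ⟩
      x + (- y + (z - w)) ≈⟨ +-congˡ (sym (+-assoc (- y) z (- w))) ⟩
      x + ((- y + z) - w) ≈⟨ +-congˡ (+-congʳ (+-comm (- y) z)) ⟩
      x + ((z - y) - w)   ≈⟨ +-congˡ (+-assoc z (- y) (- w)) ⟩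
      x + (z + (- y - w)) ≈⟨ sym (+-assoc x z _) ⟩
      (x + z) + (- y - w) ≈⟨ +-congˡ (-‿+-comm y w) ⟩
      (x + z) - (y + w)   ∎

    sub-*-sub : ∀ x y z w → (x - y) * (z - w) ≈ (x * z + y * w) - (x * w + y * z)
    sub-*-sub x y z w = begin
      (x - y) * (z - w)                         ≈⟨ distribʳ (z - w) x (- y) ⟩
      x * (z - w) + - y * (z - w)               ≈⟨ +-cong (distribˡ x z (- w)) (distribˡ (- y) z (- w)) ⟩
      (x * z + x * - w) + (- y * z + - y * - w) ≈⟨ +-cong (+-congˡ (sym (-‿distribʳ-* x w))) (+-cong (sym (-‿distribˡ-* y z)) neg-neg) ⟩
      (x * z - x * w) + (- (y * z) + y * w)     ≈⟨ +-congˡ (+-comm _ _) ⟩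
      (x * z - x * w) + (y * w - y * z)         ≈⟨ sub-+-sub _ _ _ _ ⟩
      (x * z + y * w) - (x * w + y * z)         ∎
      where
      neg-neg : - y * - w ≈ y * w
      neg-neg = begin
        - y * - w     ≈⟨ sym (-‿distribˡ-* y (- w)) ⟩
        - (y * - w)   ≈⟨ -‿cong (sym (-‿distribʳ-* y w)) ⟩
        - - (y * w)   ≈⟨ -‿involutive (y * w) ⟩
        y * w         ∎

    +-homo : ∀ p q → ⟦ RawRing._+_ Differences p q ⟧ ≈ ⟦ p ⟧ + ⟦ q ⟧
    +-homo (a , b) (c , d) = begin
      (a ℕ.+ c) ·1 1# - (b ℕ.+ d) ·1 1#          ≈⟨ +-cong (×-homo-+ 1# a c) (-‿cong (×-homo-+ 1# b d)) ⟩
      (a ·1 1# + c ·1 1#) - (b ·1 1# + d ·1 1#)  ≈⟨ sym (sub-+-sub _ _ _ _) ⟩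
      (a ·1 1# - b ·1 1#) + (c ·1 1# - d ·1 1#)  ∎

    *-homo : ∀ p q → ⟦ RawRing._*_ Differences p q ⟧ ≈ ⟦ p ⟧ * ⟦ q ⟧
    *-homo (a , b) (c , d) = begin
      (a ℕ.* c ℕ.+ b ℕ.* d) ·1 1# - (a ℕ.* d ℕ.+ b ℕ.* c) ·1 1#
        ≈⟨ +-cong (trans (×-homo-+ 1# (a ℕ.* c) (b ℕ.* d)) (+-cong (×1-homo-* a c) (×1-homo-* b d)))
                  (-‿cong (trans (×-homo-+ 1# (a ℕ.* d) (b ℕ.* c)) (+-cong (×1-homo-* a d) (×1-homo-* b c)))) ⟩
      (a ·1 1# * c ·1 1# + b ·1 1# * d ·1 1#) - (a ·1 1# * d ·1 1# + b ·1 1# * c ·1 1#)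
        ≈⟨ sym (sub-*-sub _ _ _ _) ⟩
      (a ·1 1# - b ·1 1#) * (c ·1 1# - d ·1 1#) ∎

    neg-homo : ∀ p → ⟦ RawRing.-_ Differences p ⟧ ≈ - ⟦ p ⟧
    neg-homo (a , b) = begin
      b ·1 1# - a ·1 1#       ≈⟨ +-comm _ _ ⟩
      - a ·1 1# + b ·1 1#     ≈⟨ +-congˡ (sym (-‿involutive _)) ⟩
      - a ·1 1# + - - b ·1 1# ≈⟨ -‿+-comm _ _ ⟩
      - (a ·1 1# - b ·1 1#)   ∎

    1-homo : ⟦ (1 , 0) ⟧ ≈ 1#
    1-homo = trans (+-cong (×-homo-1 1#) -0#≈0#) (+-identityʳ 1#)

    homomorphism : Differences -Raw-AlmostCommutative⟶ fromCommutativeRing CR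
    homomorphism = record
      { ⟦_⟧ = ⟦_⟧ ; +-homo = +-homo ; *-homo = *-homo ; -‿homo = neg-homo
      ; 0-homo = -‿inverseʳ 0# ; 1-homo = 1-homo }

    -- equal integers are equal in R: a - b = c - d whenever a + d = c + b
    equal? : ∀ p q → Maybe (⟦ p ⟧ ≈ ⟦ q ⟧)
    equal? (a , b) (c , d) with a ℕ.+ d ℕP.≟ c ℕ.+ b
    ... | no _ = nothing
    ... | yes a+d≡c+b = just (begin
      a ·1 1# - b ·1 1#                                 ≈⟨ sym (+-identityʳ _) ⟩
      (a ·1 1# - b ·1 1#) + 0#                          ≈⟨ +-congˡ (sym (-‿inverseʳ (d ·1 1#))) ⟩
      (a ·1 1# - b ·1 1#) + (d ·1 1# - d ·1 1#)         ≈⟨ sub-+-sub _ _ _ _ ⟩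
      (a ·1 1# + d ·1 1#) - (b ·1 1# + d ·1 1#)         ≈⟨ +-congʳ (sym (×-homo-+ 1# a d)) ⟩
      (a ℕ.+ d) ·1 1# - (b ·1 1# + d ·1 1#)             ≈⟨ +-congʳ (reflexive (≡.cong (_·1 1#) a+d≡c+b)) ⟩
      (c ℕ.+ b) ·1 1# - (b ·1 1# + d ·1 1#)             ≈⟨ +-cong (×-homo-+ 1# c b) (-‿cong (+-comm _ _)) ⟩
      (c ·1 1# + b ·1 1#) - (d ·1 1# + b ·1 1#)         ≈⟨ sym (sub-+-sub _ _ _ _) ⟩
      (c ·1 1# - d ·1 1#) + (b ·1 1# - b ·1 1#)         ≈⟨ +-congˡ (-‿inverseʳ _) ⟩
      (c ·1 1# - d ·1 1#) + 0#                          ≈⟨ +-identityʳ _ ⟩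
      c ·1 1# - d ·1 1#                                 ∎)

  open RingSolverCore Differences (fromCommutativeRing CR) homomorphism equal? public
    using (solve; _:=_; _:+_; _:*_; :-_)


-- Classical reasoning is only ever needed to prove negative statements
-- (independence, maximality, non-vanishing), so it is done in the
-- double-negation monad, where excluded middle is available.
¬¬_ : ∀ {a} → Set a → Set a
¬¬ A = ¬ ¬ A

_>>=_ : ∀ {a b} {A : Set a} {B : Set b} → ¬¬ A → (A → ¬¬ B) → ¬¬ B
(m >>= f) k = m (λ x → f x k)

return : ∀ {a} {A : Set a} → A → ¬¬ A
return x k = k x

excluded-middle : ∀ {a} (A : Set a) → ¬¬ (A ⊎ ¬ A)
excluded-middle A k = k (inj₂ (λ x → k (inj₁ x)))

all-or-counterexample : ∀ {p} {n} (P : Fin n → Set p) → ¬¬ ((∀ i → P i) ⊎ ∃ λ i → ¬ P i)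
all-or-counterexample {n = zero} P k = k (inj₁ (λ ()))
all-or-counterexample {n = suc n} P k = all-or-counterexample (λ i → P (suc i)) λ where
  (inj₂ (i , ¬Pi)) → k (inj₂ (suc i , ¬Pi))
  (inj₁ all) → excluded-middle (P zero) λ where
    (inj₁ P0) → k (inj₁ (λ { zero → P0 ; (suc i) → all i }))
    (inj₂ ¬P0) → k (inj₂ (zero , ¬P0))

module FieldFacts {f ℓ} (F : Field f ℓ) where
  open Field F hiding (zero)
  open LinAlg F public
  open CommRingSolver commutativeRing public
  open SetoidReasoning setoid public
  open RingProperties ring public
    using (+-inverseˡ-unique; -0#≈0#; -‿involutive)

  cancel-nonzero : ∀ {x y} → ¬ (x ≈ 0#) → x * y ≈ 0# → y ≈ 0#
  cancel-nonzero {x} {y} x≉0 xy≈0 with inverse x x≉0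
  ... | (x⁻¹ , xx⁻¹≈1) = begin
    y              ≈⟨ sym (*-identityˡ y) ⟩
    1# * y         ≈⟨ *-congʳ (sym xx⁻¹≈1) ⟩
    (x * x⁻¹) * y  ≈⟨ solve 3 (λ x x⁻¹ y → (x :* x⁻¹) :* y := x⁻¹ :* (x :* y)) refl x x⁻¹ y ⟩
    x⁻¹ * (x * y)  ≈⟨ *-congˡ xy≈0 ⟩
    x⁻¹ * 0#       ≈⟨ zeroʳ x⁻¹ ⟩
    0#             ∎

  nonzero-* : ∀ {x y} → ¬ (x ≈ 0#) → ¬ (y ≈ 0#) → ¬ (x * y ≈ 0#)
  nonzero-* x≉0 y≉0 xy≈0 = y≉0 (cancel-nonzero x≉0 xy≈0)

  sign : ℕ → Carrier
  sign zero = 1#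
  sign (suc n) = - sign n

  sign-nonzero : ∀ n → ¬ (sign n ≈ 0#)
  sign-nonzero n sₙ≈0 = 0≉1 (begin
    0#                ≈⟨ sym (zeroˡ (sign n)) ⟩
    0# * sign n       ≈⟨ *-congʳ (sym sₙ≈0) ⟩
    sign n * sign n   ≈⟨ square n ⟩
    1#                ∎)
    where
    square : ∀ n → sign n * sign n ≈ 1#
    square zero = *-identityˡ 1#
    square (suc n) = trans (solve 1 (λ a → :- a :* :- a := a :* a) refl (sign n)) (square n)

  ∑-cong : ∀ {n} {f g : Fin n → Carrier} → (∀ i → f i ≈ g i) → ∑ f ≈ ∑ g
  ∑-cong {zero} f≈g = refl
  ∑-cong {suc n} f≈g = +-cong (f≈g zero) (∑-cong (λ i → f≈g (suc i)))

  ∑-zero : ∀ {n} {f : Fin n → Carrier} → (∀ i → f i ≈ 0#) → ∑ f ≈ 0#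
  ∑-zero {zero} f≈0 = refl
  ∑-zero {suc n} f≈0 = trans (+-cong (f≈0 zero) (∑-zero (λ i → f≈0 (suc i)))) (+-identityʳ 0#)

  ∑-+ : ∀ {n} (f g : Fin n → Carrier) → ∑ (λ i → f i + g i) ≈ ∑ f + ∑ g
  ∑-+ {zero} f g = sym (+-identityʳ 0#)
  ∑-+ {suc n} f g = trans (+-congˡ (∑-+ (λ i → f (suc i)) (λ i → g (suc i))))
    (solve 4 (λ a b x y → (a :+ b) :+ (x :+ y) := (a :+ x) :+ (b :+ y)) refl (f zero) (g zero) _ _)

  ∑-*ˡ : ∀ {n} (x : Carrier) (f : Fin n → Carrier) → ∑ (λ i → x * f i) ≈ x * ∑ f
  ∑-*ˡ {zero} x f = sym (zeroʳ x)
  ∑-*ˡ {suc n} x f = trans (+-congˡ (∑-*ˡ x (λ i → f (suc i)))) (sym (distribˡ x _ _))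

  ∑-*ʳ : ∀ {n} (x : Carrier) (f : Fin n → Carrier) → ∑ (λ i → f i * x) ≈ ∑ f * x
  ∑-*ʳ x f = trans (∑-cong (λ i → *-comm (f i) x)) (trans (∑-*ˡ x f) (*-comm x _))

  ∑-neg : ∀ {n} (f : Fin n → Carrier) → ∑ (λ i → - f i) ≈ - ∑ f
  ∑-neg {zero} f = sym -0#≈0#
  ∑-neg {suc n} f = trans (+-congˡ (∑-neg (λ i → f (suc i))))
    (solve 2 (λ a b → :- a :+ :- b := :- (a :+ b)) refl (f zero) _)

  ∑-swap : ∀ {n m} (f : Fin n → Fin m → Carrier) →
           ∑ (λ i → ∑ (λ j → f i j)) ≈ ∑ (λ j → ∑ (λ i → f i j))
  ∑-swap {zero} f = sym (∑-zero {f = λ j → ∑ (λ i → f i j)} (λ j → refl))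
  ∑-swap {suc n} f = trans (+-congˡ (∑-swap (λ i → f (suc i))))
    (sym (∑-+ (λ j → f zero j) (λ j → ∑ (λ i → f (suc i) j))))

  ∑-single : ∀ {n} (f : Fin n → Carrier) (j : Fin n) → (∀ i → i ≢ j → f i ≈ 0#) → ∑ f ≈ f j
  ∑-single {suc n} f zero f≈0 =
    trans (+-congˡ (∑-zero (λ i → f≈0 (suc i) (λ ())))) (+-identityʳ _)
  ∑-single {suc n} f (suc j) f≈0 =
    trans (+-cong (f≈0 zero (λ ())) (∑-single (λ i → f (suc i)) j (λ i i≢j → f≈0 (suc i) (λ eq → i≢j (FinP.suc-injective eq)))))
          (+-identityˡ _)

  ∑-punchIn : ∀ {n} (f : Fin (suc n) → Carrier) (j : Fin (suc n)) → ∑ f ≈ f j + ∑ (λ i → f (punchIn j i))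
  ∑-punchIn {n} f zero = refl
  ∑-punchIn {suc n} f (suc j) = trans (+-congˡ (∑-punchIn (λ i → f (suc i)) j))
    (solve 3 (λ a b x → a :+ (b :+ x) := b :+ (a :+ x)) refl (f zero) (f (suc j)) _)

  ∑G-cong : ∀ {m n} {f g : Ground m n → Carrier} → (∀ e → f e ≈ g e) → ∑G f ≈ ∑G g
  ∑G-cong f≈g = +-cong (∑-cong (λ i → f≈g (inj₁ i))) (∑-cong (λ j → f≈g (inj₂ j)))

  ∑G-swap : ∀ {m n p} (f : Ground m n → Fin p → Carrier) →
            ∑G (λ e → ∑ (λ j → f e j)) ≈ ∑ (λ j → ∑G (λ e → f e j))
  ∑G-swap f = trans (+-cong (∑-swap (λ i → f (inj₁ i))) (∑-swap (λ i → f (inj₂ i))))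
    (sym (∑-+ (λ j → ∑ (λ i → f (inj₁ i) j)) (λ j → ∑ (λ i → f (inj₂ i) j))))

  ∑G-single : ∀ {m n} (f : Ground m n → Carrier) (e₀ : Ground m n) → (∀ e → e ≢ e₀ → f e ≈ 0#) → ∑G f ≈ f e₀
  ∑G-single f (inj₁ i₀) f≈0 = trans
    (+-cong (∑-single (λ i → f (inj₁ i)) i₀ (λ i i≢i₀ → f≈0 (inj₁ i) (λ { ≡.refl → i≢i₀ ≡.refl })))
            (∑-zero (λ j → f≈0 (inj₂ j) (λ ()))))
    (+-identityʳ _)
  ∑G-single f (inj₂ j₀) f≈0 = trans
    (+-cong (∑-zero (λ i → f≈0 (inj₁ i) (λ ())))
            (∑-single (λ j → f (inj₂ j)) j₀ (λ j j≢j₀ → f≈0 (inj₂ j) (λ { ≡.refl → j≢j₀ ≡.refl }))))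
    (+-identityˡ _)

module Determinant {f ℓ} (F : Field f ℓ) where
  open Field F hiding (zero)
  open FieldFacts F

  minor : ∀ {k p} → Matrix (suc k) (suc p) → Fin (suc p) → Matrix k p
  minor M c r c' = M (suc r) (punchIn c c')

  det : ∀ {k} → Matrix k k → Carrier
  det {zero} M = 1#
  det {suc k} M = ∑ (λ c → sign (toℕ c) * M zero c * det (minor M c))

  cofactorTerm : ∀ {k} → Matrix (suc k) (suc k) → Fin (suc k) → Carrier
  cofactorTerm M c = sign (toℕ c) * M zero c * det (minor M c)

  det-cong : ∀ {k} {M N : Matrix k k} → (∀ r c → M r c ≈ N r c) → det M ≈ det N
  det-cong {zero} M≈N = refl
  det-cong {suc k} {M} {N} M≈N = ∑-cong {f = cofactorTerm M} {g = cofactorTerm N} λ c →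
    *-cong (*-congˡ (M≈N zero c)) (det-cong (λ r c' → M≈N (suc r) (punchIn c c')))

  setCol : ∀ {k p} → Matrix k p → Fin p → (Fin k → Carrier) → Matrix k p
  setCol M l u r c with c ≟ l
  ... | yes _ = u r
  ... | no _ = M r c

  setCol-≡ : ∀ {k p} (M : Matrix k p) l u r c → c ≡ l → setCol M l u r c ≈ u r
  setCol-≡ M l u r c c≡l with c ≟ l
  ... | yes _ = refl
  ... | no c≢l = ⊥-elim (c≢l c≡l)

  setCol-≢ : ∀ {k p} (M : Matrix k p) l u r c → c ≢ l → setCol M l u r c ≈ M r c
  setCol-≢ M l u r c c≢l with c ≟ l
  ... | yes c≡l = ⊥-elim (c≢l c≡l)
  ... | no _ = refl

  setCol-cong : ∀ {k p} (M : Matrix k p) l {u u' : Fin k → Carrier} → (∀ r → u r ≈ u' r) →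
                ∀ r c → setCol M l u r c ≈ setCol M l u' r c
  setCol-cong M l {u} {u'} u≈u' r c with c ≟ l
  ... | yes _ = u≈u' r
  ... | no _ = refl

  setCol-self : ∀ {k p} (M : Matrix k p) l → ∀ r c → setCol M l (λ r → M r l) r c ≈ M r c
  setCol-self M l r c with c ≟ l
  ... | yes ≡.refl = refl
  ... | no _ = refl

  private
    punchIn≡⇒≡punchOut : ∀ {n} (c : Fin (suc n)) (c' : Fin n) (l : Fin (suc n)) (c≢l : c ≢ l) →
                         punchIn c c' ≡ l → c' ≡ punchOut c≢l
    punchIn≡⇒≡punchOut c c' l c≢l ≡.refl =
      ≡.sym (≡.trans (FinP.punchOut-cong′ c ≡.refl) (FinP.punchOut-punchIn c))

  minor-setCol : ∀ {k p} (M : Matrix (suc k) (suc p)) l u c (c≢l : c ≢ l) →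
                 ∀ r c' → minor (setCol M l u) c r c' ≈ setCol (minor M c) (punchOut c≢l) (λ r → u (suc r)) r c'
  minor-setCol M l u c c≢l r c' with c' ≟ punchOut c≢l
  ... | yes c'≡ = setCol-≡ M l u (suc r) (punchIn c c') (≡.trans (≡.cong (punchIn c) c'≡) (FinP.punchIn-punchOut c≢l))
  ... | no c'≢ = setCol-≢ M l u (suc r) (punchIn c c') (λ eq → c'≢ (punchIn≡⇒≡punchOut c c' l c≢l eq))

  minor-setCol-self : ∀ {k p} (M : Matrix (suc k) (suc p)) l u → ∀ r c' → minor (setCol M l u) l r c' ≈ minor M l r c'
  minor-setCol-self M l u r c' = setCol-≢ M l u (suc r) (punchIn l c') (FinP.punchInᵢ≢i l c')

  cofactorTerm-replaced : ∀ {k} (M : Matrix (suc k) (suc k)) l u →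
                          cofactorTerm (setCol M l u) l ≈ sign (toℕ l) * u zero * det (minor M l)
  cofactorTerm-replaced M l u =
    *-cong (*-congˡ (setCol-≡ M l u zero l ≡.refl)) (det-cong (minor-setCol-self M l u))

  cofactorTerm-kept : ∀ {k} (M : Matrix (suc k) (suc k)) l u c (c≢l : c ≢ l) →
                      cofactorTerm (setCol M l u) c
                      ≈ sign (toℕ c) * M zero c * det (setCol (minor M c) (punchOut c≢l) (λ r → u (suc r)))
  cofactorTerm-kept M l u c c≢l =
    *-cong (*-congˡ (setCol-≢ M l u zero c c≢l)) (det-cong (minor-setCol M l u c c≢l))

  det-linear : ∀ {k} (M : Matrix k k) l (a b : Carrier) (u w : Fin k → Carrier) →
               det (setCol M l (λ r → a * u r + b * w r)) ≈ a * det (setCol M l u) + b * det (setCol M l w)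
  det-linear {suc k} M l a b u w = begin
    ∑ (cofactorTerm (setCol M l v))                         ≈⟨ ∑-cong (λ c → termwise c (c ≟ l)) ⟩
    ∑ (λ c → a * cofactorTerm (setCol M l u) c + b * cofactorTerm (setCol M l w) c)
      ≈⟨ ∑-+ (λ c → a * cofactorTerm (setCol M l u) c) (λ c → b * cofactorTerm (setCol M l w) c) ⟩
    ∑ (λ c → a * cofactorTerm (setCol M l u) c) + ∑ (λ c → b * cofactorTerm (setCol M l w) c)
      ≈⟨ +-cong (∑-*ˡ a (cofactorTerm (setCol M l u))) (∑-*ˡ b (cofactorTerm (setCol M l w))) ⟩
    a * det (setCol M l u) + b * det (setCol M l w)          ∎
    where
    v = λ r → a * u r + b * w r
    termwise : ∀ c → Dec (c ≡ l) →
               cofactorTerm (setCol M l v) c ≈ a * cofactorTerm (setCol M l u) c + b * cofactorTerm (setCol M l w) c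
    termwise c (yes ≡.refl) = begin
      cofactorTerm (setCol M c v) c                   ≈⟨ cofactorTerm-replaced M c v ⟩
      s * (a * u zero + b * w zero) * D
        ≈⟨ solve 6 (λ s a u b w D → s :* (a :* u :+ b :* w) :* D := a :* (s :* u :* D) :+ b :* (s :* w :* D))
                   refl s a (u zero) b (w zero) D ⟩
      a * (s * u zero * D) + b * (s * w zero * D)
        ≈⟨ sym (+-cong (*-congˡ (cofactorTerm-replaced M c u)) (*-congˡ (cofactorTerm-replaced M c w))) ⟩
      a * cofactorTerm (setCol M c u) c + b * cofactorTerm (setCol M c w) c ∎
      where s = sign (toℕ c)
            D = det (minor M c)
    termwise c (no c≢l) = begin
      cofactorTerm (setCol M l v) c                   ≈⟨ cofactorTerm-kept M l v c c≢l ⟩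
      s * M zero c * det (setCol (minor M c) l' (λ r → v (suc r)))
        ≈⟨ *-congˡ (det-linear (minor M c) l' a b (λ r → u (suc r)) (λ r → w (suc r))) ⟩
      s * M zero c * (a * Du + b * Dw)
        ≈⟨ solve 6 (λ s m a x b y → s :* m :* (a :* x :+ b :* y) := a :* (s :* m :* x) :+ b :* (s :* m :* y))
                   refl s (M zero c) a Du b Dw ⟩
      a * (s * M zero c * Du) + b * (s * M zero c * Dw)
        ≈⟨ sym (+-cong (*-congˡ (cofactorTerm-kept M l u c c≢l)) (*-congˡ (cofactorTerm-kept M l w c c≢l))) ⟩
      a * cofactorTerm (setCol M l u) c + b * cofactorTerm (setCol M l w) c ∎
      where s = sign (toℕ c)
            l' = punchOut c≢l
            Du = det (setCol (minor M c) l' (λ r → u (suc r)))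
            Dw = det (setCol (minor M c) l' (λ r → w (suc r)))

  det-additive : ∀ {k} (M : Matrix k k) l (u w : Fin k → Carrier) →
                 det (setCol M l (λ r → u r + w r)) ≈ det (setCol M l u) + det (setCol M l w)
  det-additive M l u w = begin
    det (setCol M l (λ r → u r + w r))                  ≈⟨ det-cong (setCol-cong M l (λ r → sym (+-cong (*-identityˡ (u r)) (*-identityˡ (w r))))) ⟩
    det (setCol M l (λ r → 1# * u r + 1# * w r))        ≈⟨ det-linear M l 1# 1# u w ⟩
    1# * det (setCol M l u) + 1# * det (setCol M l w)   ≈⟨ +-cong (*-identityˡ _) (*-identityˡ _) ⟩
    det (setCol M l u) + det (setCol M l w)             ∎

  det-zero-column : ∀ {k} (M : Matrix k k) l → det (setCol M l (λ r → 0#)) ≈ 0#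
  det-zero-column M l = begin
    det (setCol M l (λ r → 0#))              ≈⟨ det-cong (setCol-cong M l (λ r → sym (trans (+-cong (zeroˡ 0#) (zeroˡ 0#)) (+-identityˡ 0#)))) ⟩
    det (setCol M l (λ r → 0# * 0# + 0# * 0#)) ≈⟨ det-linear M l 0# 0# (λ _ → 0#) (λ _ → 0#) ⟩
    0# * _ + 0# * _                           ≈⟨ +-cong (zeroˡ _) (zeroˡ _) ⟩
    0# + 0#                                   ≈⟨ +-identityˡ 0# ⟩
    0#                                        ∎

  private
    toℕ-punchIn-< : ∀ {n} (i : Fin (suc n)) (j : Fin n) → toℕ j < toℕ i → toℕ (punchIn i j) ≡ toℕ j
    toℕ-punchIn-< (suc i) zero _ = ≡.refl
    toℕ-punchIn-< (suc i) (suc j) (s≤s j<i) = ≡.cong suc (toℕ-punchIn-< i j j<i)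

    toℕ-punchIn-≥ : ∀ {n} (i : Fin (suc n)) (j : Fin n) → toℕ i ≤ toℕ j → toℕ (punchIn i j) ≡ suc (toℕ j)
    toℕ-punchIn-≥ zero j _ = ≡.refl
    toℕ-punchIn-≥ (suc i) (suc j) (s≤s i≤j) = ≡.cong suc (toℕ-punchIn-≥ i j i≤j)

    toℕ-punchOut : ∀ {n} (c i : Fin (suc n)) (c≢i : c ≢ i) →
                   (toℕ c ≤ toℕ (punchOut c≢i) × toℕ i ≡ suc (toℕ (punchOut c≢i)))
                   ⊎ (toℕ (punchOut c≢i) < toℕ c × toℕ i ≡ toℕ (punchOut c≢i))
    toℕ-punchOut c i c≢i with toℕ c ℕP.≤? toℕ (punchOut c≢i)
    ... | yes c≤ = inj₁ (c≤ , ≡.trans (≡.cong toℕ (≡.sym (FinP.punchIn-punchOut c≢i))) (toℕ-punchIn-≥ c _ c≤))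
    ... | no c≰ = inj₂ (ℕP.≰⇒> c≰ , ≡.trans (≡.cong toℕ (≡.sym (FinP.punchIn-punchOut c≢i))) (toℕ-punchIn-< c _ (ℕP.≰⇒> c≰)))

    punchIn-adjacent : ∀ {n} (i j : Fin (suc n)) → suc (toℕ i) ≡ toℕ j → ∀ c' →
                       punchIn i c' ≡ punchIn j c' ⊎ (punchIn i c' ≡ j × punchIn j c' ≡ i)
    punchIn-adjacent i j ij c' with ℕP.<-cmp (toℕ c') (toℕ i)
    ... | tri< lt _ _ = inj₁ (FinP.toℕ-injective (≡.trans (toℕ-punchIn-< i c' lt)
                               (≡.sym (toℕ-punchIn-< j c' (ℕP.<-trans lt (ℕP.≤-reflexive ij))))))
    ... | tri≈ _ eq _ = inj₂ (FinP.toℕ-injective (≡.trans (toℕ-punchIn-≥ i c' (ℕP.≤-reflexive (≡.sym eq))) (≡.trans (≡.cong suc eq) ij)) ,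
                             FinP.toℕ-injective (≡.trans (toℕ-punchIn-< j c' (≡.subst (toℕ c' <_) ij (ℕP.≤-reflexive (≡.cong suc eq)))) eq))
    ... | tri> _ _ gt = inj₁ (FinP.toℕ-injective (≡.trans (toℕ-punchIn-≥ i c' (ℕP.<⇒≤ gt))
                               (≡.sym (toℕ-punchIn-≥ j c' (≡.subst (_≤ toℕ c') ij gt)))))

    punchOut-adjacent : ∀ {n} (c i j : Fin (suc n)) (c≢i : c ≢ i) (c≢j : c ≢ j) → suc (toℕ i) ≡ toℕ j →
                        suc (toℕ (punchOut c≢i)) ≡ toℕ (punchOut c≢j)
    punchOut-adjacent c i j c≢i c≢j ij with toℕ-punchOut c i c≢i | toℕ-punchOut c j c≢j
    ... | inj₁ (_ , ei) | inj₁ (_ , ej) = ℕP.suc-injective (≡.trans (≡.cong suc (≡.sym ei)) (≡.trans ij ej))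
    ... | inj₂ (_ , ei) | inj₂ (_ , ej) = ≡.trans (≡.cong suc (≡.sym ei)) (≡.trans ij ej)
    ... | inj₁ (le , ei) | inj₂ (lt , ej) = ⊥-elim (ℕP.<-irrefl ≡.refl (ℕP.<-trans c<c lt))
      where c<c = ℕP.≤-trans (s≤s le) (ℕP.≤-trans (ℕP.≤-reflexive (≡.sym ei))
                    (ℕP.≤-trans (ℕP.n≤1+n _) (ℕP.≤-reflexive (≡.trans ij ej))))
    ... | inj₂ (lt , ei) | inj₁ (le , ej) = ⊥-elim (c≢j (FinP.toℕ-injective (ℕP.≤-antisym c≤j j≤c)))
      where
      c≤j : toℕ c ≤ toℕ j
      c≤j = ℕP.≤-trans le (ℕP.≤-trans (ℕP.n≤1+n _) (ℕP.≤-reflexive (≡.sym ej)))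
      j≤c : toℕ j ≤ toℕ c
      j≤c = ℕP.≤-trans (ℕP.≤-reflexive (≡.trans (≡.sym ij) (≡.cong suc ei))) lt

    adjacent⇒≢ : ∀ {n} (i j : Fin n) → suc (toℕ i) ≡ toℕ j → i ≢ j
    adjacent⇒≢ i j ij ≡.refl = ℕP.<-irrefl (≡.sym ij) ℕP.≤-refl

  -- Equal adjacent columns i, i+1: by induction, every term of the expansion except
  -- those at i and i+1 vanishes, and these two cancel (same minor, opposite signs).
  det-adjacent-equal : ∀ {k} (M : Matrix k k) (i j : Fin k) → suc (toℕ i) ≡ toℕ j →
                       (∀ r → M r i ≈ M r j) → det M ≈ 0#
  det-adjacent-equal {suc k} M i j ij Mi≈Mj = begin
    ∑ (cofactorTerm M)                                     ≈⟨ ∑-punchIn (cofactorTerm M) i ⟩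
    cofactorTerm M i + ∑ (λ c' → cofactorTerm M (punchIn i c')) ≈⟨ +-congˡ (∑-single _ (punchOut i≢j) others-vanish) ⟩
    cofactorTerm M i + cofactorTerm M (punchIn i (punchOut i≢j)) ≈⟨ +-congˡ (reflexive (≡.cong (cofactorTerm M) (FinP.punchIn-punchOut i≢j))) ⟩
    cofactorTerm M i + cofactorTerm M j                    ≈⟨ +-congˡ term-j ⟩
    cofactorTerm M i - cofactorTerm M i                    ≈⟨ -‿inverseʳ _ ⟩
    0#                                                     ∎
    where
    i≢j = adjacent⇒≢ i j ij
    others-vanish : ∀ c' → c' ≢ punchOut i≢j → cofactorTerm M (punchIn i c') ≈ 0#
    others-vanish c' c'≢ = trans (*-congˡ (det-adjacent-equal (minor M c) (punchOut c≢i) (punchOut c≢j)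
                                   (punchOut-adjacent c i j c≢i c≢j ij) equal)) (zeroʳ _)
      where
      c = punchIn i c'
      c≢i : c ≢ i
      c≢i = FinP.punchInᵢ≢i i c'
      c≢j : c ≢ j
      c≢j eq = c'≢ (punchIn≡⇒≡punchOut i c' j i≢j eq)
      equal : ∀ r → minor M c r (punchOut c≢i) ≈ minor M c r (punchOut c≢j)
      equal r = trans (reflexive (≡.cong (M (suc r)) (FinP.punchIn-punchOut c≢i)))
                  (trans (Mi≈Mj (suc r)) (reflexive (≡.cong (M (suc r)) (≡.sym (FinP.punchIn-punchOut c≢j)))))
    same-minor : ∀ r c' → minor M j r c' ≈ minor M i r c'
    same-minor r c' with punchIn-adjacent i j ij c'
    ... | inj₁ eq = reflexive (≡.cong (M (suc r)) (≡.sym eq))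
    ... | inj₂ (eq₁ , eq₂) = trans (reflexive (≡.cong (M (suc r)) eq₂))
                               (trans (Mi≈Mj (suc r)) (reflexive (≡.cong (M (suc r)) (≡.sym eq₁))))
    term-j : cofactorTerm M j ≈ - cofactorTerm M i
    term-j = begin
      sign (toℕ j) * M zero j * det (minor M j)   ≈⟨ *-cong (*-cong (reflexive (≡.cong sign (≡.sym ij))) (sym (Mi≈Mj zero))) (det-cong same-minor) ⟩
      - sign (toℕ i) * M zero i * det (minor M i) ≈⟨ solve 3 (λ s m d → :- s :* m :* d := :- (s :* m :* d)) refl _ _ _ ⟩
      - cofactorTerm M i                          ∎

  columnCases : ∀ {k p} (i j : Fin k) (P : Fin k → Set p) → P i → P j → (∀ c → c ≢ i → c ≢ j → P c) → ∀ c → P c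
  columnCases i j P Pi Pj Pother c with c ≟ i | c ≟ j
  ... | yes ≡.refl | _ = Pi
  ... | no _ | yes ≡.refl = Pj
  ... | no c≢i | no c≢j = Pother c c≢i c≢j

  transpose : ∀ {k} → Fin k → Fin k → Fin k → Fin k
  transpose i j c with c ≟ i
  ... | yes _ = j
  ... | no _ with c ≟ j
  ...   | yes _ = i
  ...   | no _ = c

  transpose-i : ∀ {k} (i j : Fin k) → transpose i j i ≡ j
  transpose-i i j with i ≟ i
  ... | yes _ = ≡.refl
  ... | no i≢i = ⊥-elim (i≢i ≡.refl)

  transpose-j : ∀ {k} (i j : Fin k) → i ≢ j → transpose i j j ≡ i
  transpose-j i j i≢j with j ≟ i
  ... | yes j≡i = ⊥-elim (i≢j (≡.sym j≡i))
  ... | no _ with j ≟ j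
  ...   | yes _ = ≡.refl
  ...   | no j≢j = ⊥-elim (j≢j ≡.refl)

  transpose-other : ∀ {k} (i j c : Fin k) → c ≢ i → c ≢ j → transpose i j c ≡ c
  transpose-other i j c c≢i c≢j with c ≟ i
  ... | yes c≡i = ⊥-elim (c≢i c≡i)
  ... | no _ with c ≟ j
  ...   | yes c≡j = ⊥-elim (c≢j c≡j)
  ...   | no _ = ≡.refl

  swapCols : ∀ {k p} → Matrix k p → Fin p → Fin p → Matrix k p
  swapCols M i j r c = M r (transpose i j c)

  setCols : ∀ {k p} → Matrix k p → Fin p → Fin p → (a b : Fin k → Carrier) → Matrix k p
  setCols M i j a b = setCol (setCol M j b) i a

  module _ {k p} (M : Matrix k p) (i j : Fin p) (i≢j : i ≢ j) (a b : Fin k → Carrier) where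
    setCols-i : ∀ r → setCols M i j a b r i ≈ a r
    setCols-i r = setCol-≡ _ i a r i ≡.refl

    setCols-j : ∀ r → setCols M i j a b r j ≈ b r
    setCols-j r = trans (setCol-≢ _ i a r j (λ eq → i≢j (≡.sym eq))) (setCol-≡ M j b r j ≡.refl)

    setCols-other : ∀ r c → c ≢ i → c ≢ j → setCols M i j a b r c ≈ M r c
    setCols-other r c c≢i c≢j = trans (setCol-≢ _ i a r c c≢i) (setCol-≢ M j b r c c≢j)

    setCols-comm : ∀ r c → setCol (setCol M i a) j b r c ≈ setCols M i j a b r c
    setCols-comm r = columnCases i j (λ c → setCol (setCol M i a) j b r c ≈ setCols M i j a b r c)
      (trans (setCol-≢ _ j b r i i≢j) (trans (setCol-≡ M i a r i ≡.refl) (sym (setCols-i r))))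
      (trans (setCol-≡ _ j b r j ≡.refl) (sym (setCols-j r)))
      (λ c c≢i c≢j → trans (setCol-≢ _ j b r c c≢j) (trans (setCol-≢ M i a r c c≢i) (sym (setCols-other r c c≢i c≢j))))

  -- If det vanishes whenever columns i and j agree, then exchanging them
  -- changes the sign: with u, w the columns i, j of M and D a b = det (setCols M i j a b),
  -- 0 = D (u+w) (u+w) = D u u + D w u + D u w + D w w = det (swapCols M i j) + det M.
  det-swap : ∀ {k} (i j : Fin k) → i ≢ j → (∀ (N : Matrix k k) → (∀ r → N r i ≈ N r j) → det N ≈ 0#) →
             ∀ M → det (swapCols M i j) ≈ - det M
  det-swap {k} i j i≢j alternating M = +-inverseˡ-unique _ _ (begin
    det (swapCols M i j) + det M       ≈⟨ sym (+-cong (det-cong swapped) (det-cong unchanged)) ⟩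
    D w u + D u w                      ≈⟨ sym (+-cong (+-identityˡ _) (+-identityʳ _)) ⟩
    (0# + D w u) + (D u w + 0#)        ≈⟨ sym (+-cong (+-congʳ (equal-columns u)) (+-congˡ (equal-columns w))) ⟩
    (D u u + D w u) + (D u w + D w w)  ≈⟨ sym (+-cong (additive-i u) (additive-i w)) ⟩
    D v u + D v w                      ≈⟨ sym (additive-j v) ⟩
    D v v                              ≈⟨ equal-columns v ⟩
    0#                                 ∎)
    where
    u w v : Fin k → Carrier
    u r = M r i
    w r = M r j
    v r = u r + w r
    D : (Fin k → Carrier) → (Fin k → Carrier) → Carrier
    D a b = det (setCols M i j a b)
    equal-columns : ∀ a → D a a ≈ 0#
    equal-columns a = alternating _ (λ r → trans (setCols-i M i j i≢j a a r) (sym (setCols-j M i j i≢j a a r)))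
    additive-i : ∀ b → D v b ≈ D u b + D w b
    additive-i b = det-additive (setCol M j b) i u w
    additive-j : ∀ a → D a v ≈ D a u + D a w
    additive-j a = begin
      D a v                                                                ≈⟨ sym (det-cong (setCols-comm M i j i≢j a v)) ⟩
      det (setCol (setCol M i a) j v)                                      ≈⟨ det-additive (setCol M i a) j u w ⟩
      det (setCol (setCol M i a) j u) + det (setCol (setCol M i a) j w)    ≈⟨ +-cong (det-cong (setCols-comm M i j i≢j a u))
                                                                                        (det-cong (setCols-comm M i j i≢j a w)) ⟩
      D a u + D a w                                                        ∎
    swapped : ∀ r c → setCols M i j w u r c ≈ swapCols M i j r c
    swapped r = columnCases i j (λ c → setCols M i j w u r c ≈ swapCols M i j r c)
      (trans (setCols-i M i j i≢j w u r) (reflexive (≡.cong (M r) (≡.sym (transpose-i i j)))))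
      (trans (setCols-j M i j i≢j w u r) (reflexive (≡.cong (M r) (≡.sym (transpose-j i j i≢j)))))
      (λ c c≢i c≢j → trans (setCols-other M i j i≢j w u r c c≢i c≢j) (reflexive (≡.cong (M r) (≡.sym (transpose-other i j c c≢i c≢j)))))
    unchanged : ∀ r c → setCols M i j u w r c ≈ M r c
    unchanged r = columnCases i j (λ c → setCols M i j u w r c ≈ M r c)
      (setCols-i M i j i≢j u w r) (setCols-j M i j i≢j u w r) (setCols-other M i j i≢j u w r)

  -- Two equal columns i < j: induction on the gap j - i - 1, moving column j
  -- one step to the left by an adjacent exchange, which only flips the sign.
  private
    det-equal-columns-gap : ∀ g {k} (M : Matrix k k) (i j : Fin k) → toℕ j ≡ suc (g ℕ.+ toℕ i) →
                            (∀ r → M r i ≈ M r j) → det M ≈ 0#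
    det-equal-columns-gap zero M i j j≡1+i Mi≈Mj = det-adjacent-equal M i j (≡.sym j≡1+i) Mi≈Mj
    det-equal-columns-gap (suc g) M i zero () Mi≈Mj
    det-equal-columns-gap (suc g) {suc k} M i (suc j₀) j≡ Mi≈Mj = begin
      det M            ≈⟨ sym (-‿involutive _) ⟩
      - - det M        ≈⟨ -‿cong (sym (det-swap j' (suc j₀) j'≢j (λ N → det-adjacent-equal N j' (suc j₀) adjacent) M)) ⟩
      - det M'         ≈⟨ -‿cong (det-equal-columns-gap g M' i j' j'≡ M'i≈M'j') ⟩
      - 0#             ≈⟨ -0#≈0# ⟩
      0#               ∎
      where
      j' : Fin (suc k)
      j' = Fin.inject₁ j₀
      j'≡ : toℕ j' ≡ suc (g ℕ.+ toℕ i)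
      j'≡ = ≡.trans (FinP.toℕ-inject₁ j₀) (ℕP.suc-injective j≡)
      adjacent : suc (toℕ j') ≡ toℕ (suc j₀)
      adjacent = ≡.cong suc (FinP.toℕ-inject₁ j₀)
      j'≢j : j' ≢ suc j₀
      j'≢j = adjacent⇒≢ j' (suc j₀) adjacent
      M' = swapCols M j' (suc j₀)
      i≢j' : i ≢ j'
      i≢j' eq = ℕP.<-irrefl (≡.cong toℕ eq) (≡.subst (toℕ i <_) (≡.sym j'≡) (s≤s (ℕP.m≤n+m (toℕ i) g)))
      i≢j : i ≢ suc j₀
      i≢j eq = ℕP.<-irrefl (≡.cong toℕ eq) (≡.subst (toℕ i <_) (≡.sym j≡) (s≤s (ℕP.m≤n+m (toℕ i) (suc g))))
      M'i≈M'j' : ∀ r → M' r i ≈ M' r j'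
      M'i≈M'j' r = trans (reflexive (≡.cong (M r) (transpose-other j' (suc j₀) i i≢j' i≢j)))
                     (trans (Mi≈Mj r) (reflexive (≡.cong (M r) (≡.sym (transpose-i j' (suc j₀))))))

  det-equal-columns : ∀ {k} (M : Matrix k k) (i j : Fin k) → i ≢ j → (∀ r → M r i ≈ M r j) → det M ≈ 0#
  det-equal-columns M i j i≢j Mi≈Mj with ℕP.<-cmp (toℕ i) (toℕ j)
  ... | tri< i<j _ _ = det-equal-columns-gap (toℕ j ℕ.∸ suc (toℕ i)) M i j
                         (≡.sym (≡.trans (≡.sym (ℕP.+-suc _ (toℕ i))) (ℕP.m∸n+n≡m i<j))) Mi≈Mj
  ... | tri≈ _ i≡j _ = ⊥-elim (i≢j (FinP.toℕ-injective i≡j))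
  ... | tri> _ _ j<i = det-equal-columns-gap (toℕ i ℕ.∸ suc (toℕ j)) M j i
                         (≡.sym (≡.trans (≡.sym (ℕP.+-suc _ (toℕ j))) (ℕP.m∸n+n≡m j<i))) (λ r → sym (Mi≈Mj r))

module ColumnIndependence {f ℓ} (F : Field f ℓ) where
  open Field F hiding (zero)
  open FieldFacts F
  open Determinant F

  ColumnsIndependent : ∀ {k p} → Matrix k p → Set (f ⊔ ℓ)
  ColumnsIndependent {k} {p} M =
    (a : Fin p → Carrier) → (∀ r → ∑ (λ j → a j * M r j) ≈ 0#) → ∀ j → a j ≈ 0#

  ColumnsIndependent-cong : ∀ {k p} {M N : Matrix k p} → (∀ r c → M r c ≈ N r c) →
                            ColumnsIndependent M → ColumnsIndependent N
  ColumnsIndependent-cong M≈N ind a rel = ind a (λ r → trans (∑-cong (λ c → *-congˡ (M≈N r c))) (rel r))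

  det-combination : ∀ {k p} (M : Matrix k k) l (a : Fin p → Carrier) (U : Fin p → Fin k → Carrier) →
                    det (setCol M l (λ r → ∑ (λ t → a t * U t r))) ≈ ∑ (λ t → a t * det (setCol M l (U t)))
  det-combination {p = zero} M l a U = det-zero-column M l
  det-combination {p = suc p} M l a U = begin
    det (setCol M l (λ r → ∑ (λ t → a t * U t r)))
      ≈⟨ det-cong (setCol-cong M l (λ r → +-congˡ (sym (*-identityˡ _)))) ⟩
    det (setCol M l (λ r → a zero * U zero r + 1# * ∑ (λ t → a (suc t) * U (suc t) r)))
      ≈⟨ det-linear M l (a zero) 1# _ _ ⟩
    a zero * det (setCol M l (U zero)) + 1# * det (setCol M l (λ r → ∑ (λ t → a (suc t) * U (suc t) r)))
      ≈⟨ +-congˡ (trans (*-identityˡ _) (det-combination M l (λ t → a (suc t)) (λ t → U (suc t)))) ⟩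
    a zero * det (setCol M l (U zero)) + ∑ (λ t → a (suc t) * det (setCol M l (U (suc t)))) ∎

  -- Cramer's rule: if ∑ a t · (column t) = 0 then a l · det M = det (M with column l := 0) = 0
  det≉0⇒independent : ∀ {k} (M : Matrix k k) → ¬ (det M ≈ 0#) → ColumnsIndependent M
  det≉0⇒independent M det≉0 a rel l = cancel-nonzero det≉0 (trans (*-comm _ _) (sym aₗdet≈0))
    where
    column : Fin _ → Fin _ → Carrier
    column t r = M r t
    others-vanish : ∀ t → t ≢ l → a t * det (setCol M l (column t)) ≈ 0#
    others-vanish t t≢l = trans (*-congˡ (det-equal-columns _ l t (λ eq → t≢l (≡.sym eq))
      (λ r → trans (setCol-≡ M l (column t) r l ≡.refl) (sym (setCol-≢ M l (column t) r t t≢l))))) (zeroʳ _)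
    aₗdet≈0 : 0# ≈ a l * det M
    aₗdet≈0 = begin
      0#                                                    ≈⟨ sym (det-zero-column M l) ⟩
      det (setCol M l (λ r → 0#))                           ≈⟨ det-cong (setCol-cong M l (λ r → sym (rel r))) ⟩
      det (setCol M l (λ r → ∑ (λ t → a t * column t r)))   ≈⟨ det-combination M l a column ⟩
      ∑ (λ t → a t * det (setCol M l (column t)))           ≈⟨ ∑-single _ l others-vanish ⟩
      a l * det (setCol M l (column l))                     ≈⟨ *-congˡ (det-cong (setCol-self M l)) ⟩
      a l * det M                                           ∎

  det-add-column : ∀ {k} (M : Matrix k k) l j (t : Carrier) → l ≢ j →
                   det (setCol M l (λ r → M r l + t * M r j)) ≈ det M
  det-add-column M l j t l≢j = begin
    det (setCol M l (λ r → M r l + t * M r j))             ≈⟨ det-cong (setCol-cong M l (λ r → +-congʳ (sym (*-identityˡ _)))) ⟩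
    det (setCol M l (λ r → 1# * M r l + t * M r j))        ≈⟨ det-linear M l 1# t _ _ ⟩
    1# * det (setCol M l (λ r → M r l)) + t * det (setCol M l (λ r → M r j))
      ≈⟨ +-cong (trans (*-identityˡ _) (det-cong (setCol-self M l))) (trans (*-congˡ repeated) (zeroʳ t)) ⟩
    det M + 0#                                             ≈⟨ +-identityʳ _ ⟩
    det M                                                  ∎
    where
    repeated : det (setCol M l (λ r → M r j)) ≈ 0#
    repeated = det-equal-columns _ l j l≢j
      (λ r → trans (setCol-≡ M l _ r l ≡.refl) (sym (setCol-≢ M l _ r j (λ eq → l≢j (≡.sym eq)))))

  -- Adding t c times column j to every column c (with t j = 0) does not change
  -- det: apply det-add-column to the columns 0, 1, …, k-1 in turn.
  module AddMultiplesOfColumn {k} (M : Matrix k k) (j : Fin k) (t : Fin k → Carrier) (tⱼ≈0 : t j ≈ 0#) where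
    partial : ℕ → Matrix k k
    partial n r c = case toℕ c ℕP.<? n of λ where
      (yes _) → M r c + t c * M r j
      (no _) → M r c

    partial-done : ∀ n r c → toℕ c < n → partial n r c ≈ M r c + t c * M r j
    partial-done n r c c<n with toℕ c ℕP.<? n
    ... | yes _ = refl
    ... | no c≮n = ⊥-elim (c≮n c<n)

    partial-todo : ∀ n r c → ¬ (toℕ c < n) → partial n r c ≈ M r c
    partial-todo n r c c≮n with toℕ c ℕP.<? n
    ... | yes c<n = ⊥-elim (c≮n c<n)
    ... | no _ = refl

    partial-j : ∀ n r → partial n r j ≈ M r j
    partial-j n r with toℕ j ℕP.<? n
    ... | yes _ = trans (+-congˡ (trans (*-congʳ tⱼ≈0) (zeroˡ _))) (+-identityʳ _)
    ... | no _ = refl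

    step : ∀ n → det (partial (suc n)) ≈ det (partial n)
    step n with n ℕP.<? k
    ... | no n≮k = det-cong λ r c →
      trans (partial-done (suc n) r c (ℕP.≤-trans (FinP.toℕ<n c) (ℕP.≤-trans (ℕP.≮⇒≥ n≮k) (ℕP.n≤1+n n))))
            (sym (partial-done n r c (ℕP.≤-trans (FinP.toℕ<n c) (ℕP.≮⇒≥ n≮k))))
    ... | yes n<k = trans (det-cong one-more-column) add-column-l
      where
      l = Fin.fromℕ< n<k
      l≡n : toℕ l ≡ n
      l≡n = FinP.toℕ-fromℕ< n<k
      N = partial n
      other-columns : ∀ r c → c ≢ l → partial (suc n) r c ≈ partial n r c
      other-columns r c c≢l with ℕP.<-cmp (toℕ c) n
      ... | tri< c<n _ _ = trans (partial-done (suc n) r c (ℕP.≤-trans c<n (ℕP.n≤1+n n))) (sym (partial-done n r c c<n))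
      ... | tri≈ _ c≡n _ = ⊥-elim (c≢l (FinP.toℕ-injective (≡.trans c≡n (≡.sym l≡n))))
      ... | tri> _ _ c>n = trans (partial-todo (suc n) r c (λ c<1+n → ℕP.<-irrefl ≡.refl (ℕP.<-≤-trans c>n (ℕP.≤-pred c<1+n))))
                                 (sym (partial-todo n r c (λ c<n → ℕP.<-asym c<n c>n)))
      one-more-column : ∀ r c → partial (suc n) r c ≈ setCol N l (λ r → N r l + t l * N r j) r c
      one-more-column r c = case c ≟ l of λ where
        (yes ≡.refl) → trans (partial-done (suc n) r c (ℕP.≤-reflexive (≡.cong suc l≡n)))
                         (sym (trans (setCol-≡ N c _ r c ≡.refl)
                                     (+-cong (partial-todo n r c (λ c<n → ℕP.<-irrefl l≡n c<n)) (*-congˡ (partial-j n r)))))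
        (no c≢l) → trans (other-columns r c c≢l) (sym (setCol-≢ N l _ r c c≢l))
      add-column-l : det (setCol N l (λ r → N r l + t l * N r j)) ≈ det N
      add-column-l = case l ≟ j of λ where
        (no l≢j) → det-add-column N l j (t l) l≢j
        (yes ≡.refl) → det-cong λ r c → trans (setCol-cong N l (λ r → trans (+-congˡ (trans (*-congʳ tⱼ≈0) (zeroˡ _))) (+-identityʳ _)) r c)
                                              (setCol-self N l r c)

    partial-det : ∀ n → det (partial n) ≈ det M
    partial-det zero = det-cong (λ r c → partial-todo 0 r c (λ ()))
    partial-det (suc n) = trans (step n) (partial-det n)

    det-add-multiples : det (λ r c → M r c + t c * M r j) ≈ det M
    det-add-multiples = trans (det-cong (λ r c → sym (partial-done k r c (FinP.toℕ<n c)))) (partial-det k)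

  split-at-pivot : ∀ {p} (b v q : Fin (suc p) → Carrier) (j : Fin (suc p)) →
                   ∑ (λ c → b c * v c)
                   ≈ (b j + ∑ (λ c' → b (punchIn j c') * q (punchIn j c'))) * v j
                     + ∑ (λ c' → b (punchIn j c') * (v (punchIn j c') - q (punchIn j c') * v j))
  split-at-pivot b v q j = begin
    ∑ (λ c → b c * v c)                      ≈⟨ ∑-punchIn (λ c → b c * v c) j ⟩
    b j * v j + Sv
      ≈⟨ solve 4 (λ bj vj sv sq → bj :* vj :+ sv := (bj :+ sq) :* vj :+ (sv :+ :- (sq :* vj))) refl (b j) (v j) Sv Sq ⟩
    (b j + Sq) * v j + (Sv - Sq * v j)       ≈⟨ +-congˡ (sym reduced-sum) ⟩
    (b j + Sq) * v j + ∑ (λ c' → b' c' * (v' c' - q' c' * v j)) ∎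
    where
    b' v' q' : Fin _ → Carrier
    b' c' = b (punchIn j c')
    v' c' = v (punchIn j c')
    q' c' = q (punchIn j c')
    Sv = ∑ (λ c' → b' c' * v' c')
    Sq = ∑ (λ c' → b' c' * q' c')
    reduced-sum : ∑ (λ c' → b' c' * (v' c' - q' c' * v j)) ≈ Sv - Sq * v j
    reduced-sum = begin
      ∑ (λ c' → b' c' * (v' c' - q' c' * v j))
        ≈⟨ ∑-cong (λ c' → solve 4 (λ b v q w → b :* (v :+ :- (q :* w)) := b :* v :+ :- (b :* q :* w)) refl (b' c') (v' c') (q' c') (v j)) ⟩
      ∑ (λ c' → b' c' * v' c' + - (b' c' * q' c' * v j))
        ≈⟨ ∑-+ (λ c' → b' c' * v' c') (λ c' → - (b' c' * q' c' * v j)) ⟩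
      Sv + ∑ (λ c' → - (b' c' * q' c' * v j))  ≈⟨ +-congˡ (∑-neg (λ c' → b' c' * q' c' * v j)) ⟩
      Sv - ∑ (λ c' → b' c' * q' c' * v j)      ≈⟨ +-congˡ (-‿cong (∑-*ʳ (v j) (λ c' → b' c' * q' c'))) ⟩
      Sv - Sq * v j                            ∎

  -- Gaussian elimination of the first row with a pivot M 0 j ≉ 0 (y = (M 0 j)⁻¹):
  -- subtract q c = M 0 c · y times column j from every column c and delete
  -- row 0 and column j.
  module Pivot {k p} (M : Matrix (suc k) (suc p)) (j : Fin (suc p)) (y : Carrier) (M₀ⱼy≈1 : M zero j * y ≈ 1#) where
    q : Fin (suc p) → Carrier
    q c = M zero c * y

    reduce : Matrix k p
    reduce r c' = M (suc r) (punchIn j c') - q (punchIn j c') * M (suc r) j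

    row₀-cleared : ∀ c → M zero c - q c * M zero j ≈ 0#
    row₀-cleared c = begin
      M zero c - M zero c * y * M zero j    ≈⟨ +-congˡ (-‿cong (solve 3 (λ m y mj → m :* y :* mj := m :* (mj :* y)) refl (M zero c) y (M zero j))) ⟩
      M zero c - M zero c * (M zero j * y)  ≈⟨ +-congˡ (-‿cong (*-congˡ M₀ⱼy≈1)) ⟩
      M zero c - M zero c * 1#              ≈⟨ +-congˡ (-‿cong (*-identityʳ _)) ⟩
      M zero c - M zero c                   ≈⟨ -‿inverseʳ _ ⟩
      0#                                    ∎

    pivot-coefficient : (Fin (suc p) → Carrier) → Carrier
    pivot-coefficient b = b j + ∑ (λ c' → b (punchIn j c') * q (punchIn j c'))

    row₀-relation : ∀ b → ∑ (λ c → b c * M zero c) ≈ pivot-coefficient b * M zero j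
    row₀-relation b = trans (split-at-pivot b (M zero) q j)
      (trans (+-congˡ (∑-zero (λ c' → trans (*-congˡ (row₀-cleared (punchIn j c'))) (zeroʳ _)))) (+-identityʳ _))

    rowₛ-relation : ∀ b r → ∑ (λ c → b c * M (suc r) c)
                            ≈ pivot-coefficient b * M (suc r) j + ∑ (λ c' → b (punchIn j c') * reduce r c')
    rowₛ-relation b r = split-at-pivot b (M (suc r)) q j

    -- a relation among the reduced columns lifts to one among the columns of M
    reduce-independent : ColumnsIndependent M → ColumnsIndependent reduce
    reduce-independent ind a' rel' c' =
      trans (reflexive (≡.sym (VecFP.insertAt-punchIn a' j aⱼ c'))) (ind a rel (punchIn j c'))
      where
      aⱼ = - ∑ (λ c' → a' c' * q (punchIn j c'))
      a = insertAt a' j aⱼ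
      a-punchIn : ∀ c' → a (punchIn j c') ≡ a' c'
      a-punchIn = VecFP.insertAt-punchIn a' j aⱼ
      coefficient≈0 : pivot-coefficient a ≈ 0#
      coefficient≈0 = begin
        a j + ∑ (λ c' → a (punchIn j c') * q (punchIn j c'))
          ≈⟨ +-cong (reflexive (VecFP.insertAt-lookup a' j aⱼ)) (∑-cong (λ c' → *-congʳ (reflexive (a-punchIn c')))) ⟩
        aⱼ + ∑ (λ c' → a' c' * q (punchIn j c'))  ≈⟨ +-comm _ _ ⟩
        ∑ (λ c' → a' c' * q (punchIn j c')) + aⱼ  ≈⟨ -‿inverseʳ _ ⟩
        0#                                         ∎
      rel : ∀ r → ∑ (λ c → a c * M r c) ≈ 0#
      rel zero = trans (row₀-relation a) (trans (*-congʳ coefficient≈0) (zeroˡ _))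
      rel (suc r) = trans (rowₛ-relation a r)
        (trans (+-cong (trans (*-congʳ coefficient≈0) (zeroˡ _))
                       (trans (∑-cong (λ c' → *-congʳ (reflexive (a-punchIn c')))) (rel' r)))
               (+-identityˡ 0#))

  lowerRows : ∀ {k p} → Matrix (suc k) p → Matrix k p
  lowerRows M r c = M (suc r) c

  lowerRows-independent : ∀ {k p} (M : Matrix (suc k) p) → (∀ c → M zero c ≈ 0#) →
                          ColumnsIndependent M → ColumnsIndependent (lowerRows M)
  lowerRows-independent M row₀≈0 ind a rel = ind a λ where
    zero → ∑-zero (λ c → trans (*-congˡ (row₀≈0 c)) (zeroʳ _))
    (suc r) → rel r

  more-columns-than-rows⇒dependent : ∀ k p → k < p → (M : Matrix k p) → ¬ ColumnsIndependent M
  more-columns-than-rows⇒dependent zero (suc p) _ M ind = 0≉1 (sym (ind (λ _ → 1#) (λ ()) zero))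
  more-columns-than-rows⇒dependent (suc k) (suc p) (s≤s k<p) M ind =
    all-or-counterexample (λ c → M zero c ≈ 0#) λ where
      (inj₁ row₀≈0) → more-columns-than-rows⇒dependent k (suc p) (ℕP.≤-trans k<p (ℕP.n≤1+n p))
                        (lowerRows M) (lowerRows-independent M row₀≈0 ind)
      (inj₂ (j , M₀ⱼ≉0)) → case inverse (M zero j) M₀ⱼ≉0 of λ where
        (y , M₀ⱼy≈1) → more-columns-than-rows⇒dependent k p k<p (Pivot.reduce M j y M₀ⱼy≈1)
                          (Pivot.reduce-independent M j y M₀ⱼy≈1 ind)

  unitVector : ∀ {k} → Fin k → Fin k → Carrier
  unitVector i r = if ⌊ i ≟ r ⌋ then 1# else 0#

  unitVector-suc : ∀ {k} (i r : Fin k) → unitVector (suc i) (suc r) ≈ unitVector i r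
  unitVector-suc i r with i ≟ r
  ... | yes _ = refl
  ... | no _ = refl

  addUnitColumn : ∀ {k s} → Fin k → Matrix k s → Matrix k (suc s)
  addUnitColumn i M r zero = unitVector i r
  addUnitColumn i M r (suc c) = M r c

  addUnitColumn-row₀-zero : ∀ {k s} (M : Matrix (suc k) (suc s)) → ColumnsIndependent M → (∀ c → M zero c ≈ 0#) →
                            ColumnsIndependent (addUnitColumn zero M)
  addUnitColumn-row₀-zero M ind row₀≈0 a rel = λ { zero → a₀≈0 ; (suc c) → ind (λ c → a (suc c)) relM c }
    where
    row₀-sum≈0 : ∑ (λ c → a (suc c) * M zero c) ≈ 0#
    row₀-sum≈0 = ∑-zero {f = λ c → a (suc c) * M zero c} (λ c → trans (*-congˡ (row₀≈0 c)) (zeroʳ _))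
    a₀≈0 : a zero ≈ 0#
    a₀≈0 = trans (sym (*-identityʳ _)) (trans (sym (+-identityʳ _)) (trans (+-congˡ (sym row₀-sum≈0)) (rel zero)))
    relM : ∀ r → ∑ (λ c → a (suc c) * M r c) ≈ 0#
    relM zero = row₀-sum≈0
    relM (suc r) = trans (sym (+-identityˡ _)) (trans (+-congʳ (sym (zeroʳ (a zero)))) (rel (suc r)))

  addUnitColumn-pivot : ∀ {k s} (M : Matrix (suc k) (suc s)) j → ¬ (M zero j ≈ 0#) → ∀ y (M₀ⱼy≈1 : M zero j * y ≈ 1#) →
                        ∀ i → ColumnsIndependent (addUnitColumn i (Pivot.reduce M j y M₀ⱼy≈1)) →
                        ColumnsIndependent (addUnitColumn (suc i) M)
  addUnitColumn-pivot {k} {s} M j M₀ⱼ≉0 y M₀ⱼy≈1 i ind' a rel = λ { zero → a'≈0 zero ; (suc c) → b≈0 c }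
    where
    open Pivot M j y M₀ⱼy≈1
    b : Fin (suc s) → Carrier
    b c = a (suc c)
    row₀-sum≈0 : ∑ (λ c → b c * M zero c) ≈ 0#
    row₀-sum≈0 = trans (sym (+-identityˡ _)) (trans (+-congʳ (sym (zeroʳ (a zero)))) (rel zero))
    coefficient≈0 : pivot-coefficient b ≈ 0#
    coefficient≈0 = cancel-nonzero M₀ⱼ≉0 (trans (*-comm _ _) (trans (sym (row₀-relation b)) row₀-sum≈0))
    a' : Fin (suc s) → Carrier
    a' zero = a zero
    a' (suc c') = b (punchIn j c')
    rel' : ∀ r → ∑ (λ c → a' c * addUnitColumn i reduce r c) ≈ 0#
    rel' r = begin
      a zero * unitVector i r + ∑ (λ c' → b (punchIn j c') * reduce r c')
        ≈⟨ +-congˡ (sym (trans (rowₛ-relation b r) (trans (+-congʳ (trans (*-congʳ coefficient≈0) (zeroˡ _))) (+-identityˡ _)))) ⟩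
      a zero * unitVector i r + ∑ (λ c → b c * M (suc r) c)
        ≈⟨ +-congʳ (*-congˡ (sym (unitVector-suc i r))) ⟩
      a zero * unitVector (suc i) (suc r) + ∑ (λ c → b c * M (suc r) c)
        ≈⟨ rel (suc r) ⟩
      0# ∎
    a'≈0 = ind' a' rel'
    b≈0 : ∀ c → b c ≈ 0#
    b≈0 c = case c ≟ j of λ where
      (yes ≡.refl) → trans (sym (+-identityʳ _)) (trans (+-congˡ (sym (∑-zero (λ c' → trans (*-congʳ (a'≈0 (suc c'))) (zeroˡ _))))) coefficient≈0)
      (no c≢j) → trans (reflexive (≡.cong b (≡.sym (FinP.punchIn-punchOut (λ eq → c≢j (≡.sym eq))))))
                       (a'≈0 (suc (punchOut (λ eq → c≢j (≡.sym eq)))))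

  extend-by-unitVector : ∀ k s → s < k → (M : Matrix k s) → ColumnsIndependent M →
                         ¬¬ (∃ λ i → ColumnsIndependent (addUnitColumn i M))
  extend-by-unitVector (suc k) zero _ M ind = return (zero , λ a rel → λ where
    zero → trans (sym (*-identityʳ _)) (trans (sym (+-identityʳ _)) (rel zero)))
  extend-by-unitVector (suc k) (suc s) (s≤s s<k) M ind = all-or-counterexample (λ c → M zero c ≈ 0#) >>= λ where
    (inj₁ row₀≈0) → return (zero , addUnitColumn-row₀-zero M ind row₀≈0)
    (inj₂ (j , M₀ⱼ≉0)) → case inverse (M zero j) M₀ⱼ≉0 of λ where
      (y , M₀ⱼy≈1) → extend-by-unitVector k s s<k (Pivot.reduce M j y M₀ⱼy≈1) (Pivot.reduce-independent M j y M₀ⱼy≈1 ind) >>= λ where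
        (i , ind') → return (suc i , addUnitColumn-pivot M j M₀ⱼ≉0 y M₀ⱼy≈1 i ind')

  det-pivot : ∀ {k} (M : Matrix (suc k) (suc k)) (j : Fin (suc k)) (y : Carrier) (M₀ⱼy≈1 : M zero j * y ≈ 1#) →
              det M ≈ sign (toℕ j) * M zero j * det (Pivot.reduce M j y M₀ⱼy≈1)
  det-pivot M j y M₀ⱼy≈1 = begin
    det M                                    ≈⟨ sym (AddMultiplesOfColumn.det-add-multiples M j t tⱼ≈0) ⟩
    det N                                    ≈⟨ ∑-single (cofactorTerm N) j only-j ⟩
    sign (toℕ j) * N zero j * det (minor N j)
      ≈⟨ *-cong (*-congˡ (trans (+-congˡ (trans (*-congʳ tⱼ≈0) (zeroˡ _))) (+-identityʳ _)))
                (det-cong (λ r c' → trans (+-congˡ (*-congʳ (t-other (punchIn j c') (FinP.punchInᵢ≢i j c')))) (neg-* _ _ _))) ⟩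
    sign (toℕ j) * M zero j * det reduce     ∎
    where
    open Pivot M j y M₀ⱼy≈1
    t : Fin _ → Carrier
    t c = case c ≟ j of λ where
      (yes _) → 0#
      (no _) → - q c
    tⱼ≈0 : t j ≈ 0#
    tⱼ≈0 with j ≟ j
    ... | yes _ = refl
    ... | no j≢j = ⊥-elim (j≢j ≡.refl)
    t-other : ∀ c → c ≢ j → t c ≈ - q c
    t-other c c≢j with c ≟ j
    ... | yes c≡j = ⊥-elim (c≢j c≡j)
    ... | no _ = refl
    N : Matrix _ _
    N r c = M r c + t c * M r j
    neg-* : ∀ a b x → a + - b * x ≈ a - b * x
    neg-* a b x = +-congˡ (solve 2 (λ b x → :- b :* x := :- (b :* x)) refl b x)
    -- after the column operations only the term at j survives in row 0
    only-j : ∀ c → c ≢ j → cofactorTerm N c ≈ 0#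
    only-j c c≢j = trans (*-congʳ (trans (*-congˡ (trans (+-congˡ (*-congʳ (t-other c c≢j)))
                     (trans (neg-* _ _ _) (row₀-cleared c)))) (zeroʳ _))) (zeroˡ _)

  independent⇒det≉0 : ∀ k (M : Matrix k k) → ColumnsIndependent M → ¬ (det M ≈ 0#)
  independent⇒det≉0 zero M ind det≈0 = 0≉1 (sym det≈0)
  independent⇒det≉0 (suc k) M ind det≈0 = all-or-counterexample (λ c → M zero c ≈ 0#) λ where
    (inj₁ row₀≈0) → more-columns-than-rows⇒dependent k (suc k) ℕP.≤-refl (lowerRows M) (lowerRows-independent M row₀≈0 ind)
    (inj₂ (j , M₀ⱼ≉0)) → case inverse (M zero j) M₀ⱼ≉0 of λ where
      (y , M₀ⱼy≈1) → nonzero-* (nonzero-* (sign-nonzero (toℕ j)) M₀ⱼ≉0)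
                        (independent⇒det≉0 k (Pivot.reduce M j y M₀ⱼy≈1) (Pivot.reduce-independent M j y M₀ⱼy≈1 ind))
                        (trans (sym (det-pivot M j y M₀ⱼy≈1)) det≈0)

∨-introˡ : ∀ {a b} → T a → T (a ∨ b)
∨-introˡ {true} _ = tt

∨-introʳ : ∀ a {b} → T b → T (a ∨ b)
∨-introʳ true _ = tt
∨-introʳ false t = t

∨-elim : ∀ a {b} → T (a ∨ b) → T a ⊎ T b
∨-elim true t = inj₁ tt
∨-elim false t = inj₂ t

∧-intro : ∀ {a b} → T a → T b → T (a ∧ b)
∧-intro {true} {true} _ _ = tt

∧-elimˡ : ∀ a {b} → T (a ∧ b) → T a
∧-elimˡ true _ = tt

∧-elimʳ : ∀ a {b} → T (a ∧ b) → T b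
∧-elimʳ true t = t

not-intro : ∀ {a} → ¬ T a → T (not a)
not-intro {true} ¬t = ¬t tt
not-intro {false} _ = tt

not-elim : ∀ {a} → T (not a) → ¬ T a
not-elim {true} () _
not-elim {false} _ ()

not-not : ∀ {a} → ¬ T (not a) → T a
not-not {true} _ = tt
not-not {false} ¬t = ¬t tt

de-morgan : ∀ a b → not (not a ∧ not b) ≡ a ∨ b
de-morgan true b = ≡.refl
de-morgan false true = ≡.refl
de-morgan false false = ≡.refl

T⇒≡true : ∀ {a} → T a → a ≡ true
T⇒≡true {true} _ = ≡.refl

≡true⇒T : ∀ {a} → a ≡ true → T a
≡true⇒T ≡.refl = tt

¬T⇒≡false : ∀ {a} → ¬ T a → a ≡ false
¬T⇒≡false {true} ¬t = ⊥-elim (¬t tt)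
¬T⇒≡false {false} _ = ≡.refl

⌊⌋-no : ∀ {a} {A : Set a} (d : Dec A) → ¬ A → ¬ T ⌊ d ⌋
⌊⌋-no (yes x) ¬x _ = ¬x x
⌊⌋-no (no _) _ ()

⌊⌋-refl : ∀ {n} (i : Fin n) → T ⌊ i ≟ i ⌋
⌊⌋-refl i = fromWitness ≡.refl

count-cong : ∀ {n} {C D : Subset (Fin n)} → (∀ i → C i ≡ D i) → count C ≡ count D
count-cong {zero} C≡D = ≡.refl
count-cong {suc n} C≡D = ≡.cong₂ ℕ._+_ (≡.cong (λ b → if b then 1 else 0) (C≡D zero)) (count-cong (λ i → C≡D (suc i)))

count-empty : ∀ {n} → count {n} (λ _ → false) ≡ 0
count-empty {zero} = ≡.refl
count-empty {suc n} = count-empty {n}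

count-nonempty : ∀ {n k} (D : Subset (Fin n)) → count D ≡ suc k → ∃ λ j → T (D j)
count-nonempty {zero} D ()
count-nonempty {suc n} D eq with D zero in D₀
... | true = zero , ≡true⇒T D₀
... | false = case count-nonempty (λ i → D (suc i)) eq of λ where
  (j , t) → suc j , t

count-mono : ∀ {n} (D C : Subset (Fin n)) → D ⊆ C → count D ≤ count C
count-mono {zero} D C D⊆C = z≤n
count-mono {suc n} D C D⊆C with D zero in D₀ | C zero in C₀
... | true | true = s≤s (count-mono _ _ (λ i → D⊆C (suc i)))
... | false | true = ℕP.≤-trans (count-mono _ _ (λ i → D⊆C (suc i))) (ℕP.n≤1+n _)
... | false | false = count-mono _ _ (λ i → D⊆C (suc i))
... | true | false = ⊥-elim (≡.subst T C₀ (D⊆C zero (≡true⇒T D₀)))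

count-≡⇒⊇ : ∀ {n} (D C : Subset (Fin n)) → D ⊆ C → count D ≡ count C → C ⊆ D
count-≡⇒⊇ {suc n} D C D⊆C eq i t with D zero in D₀ | C zero in C₀
... | true | false = ⊥-elim (≡.subst T C₀ (D⊆C zero (≡true⇒T D₀)))
... | false | true = ⊥-elim (ℕP.<-irrefl eq (s≤s (count-mono _ _ (λ i → D⊆C (suc i)))))
... | true | true = tail-included i t
  where tail-included : C ⊆ D
        tail-included zero _ = ≡true⇒T D₀
        tail-included (suc i') t = count-≡⇒⊇ _ _ (λ i → D⊆C (suc i)) (ℕP.suc-injective eq) i' t
... | false | false = tail-included i t
  where tail-included : C ⊆ D
        tail-included zero t = ⊥-elim (≡.subst T C₀ t)
        tail-included (suc i') t = count-≡⇒⊇ _ _ (λ i → D⊆C (suc i)) eq i' t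

private
  ⌊suc≟suc⌋ : ∀ {n} (i j : Fin n) → ⌊ suc i ≟ suc j ⌋ ≡ ⌊ i ≟ j ⌋
  ⌊suc≟suc⌋ i j with i ≟ j
  ... | yes _ = ≡.refl
  ... | no _ = ≡.refl

count-remove : ∀ {n} (C : Subset (Fin n)) j → T (C j) → count C ≡ suc (count (λ i → C i ∧ not ⌊ i ≟ j ⌋))
count-remove {suc n} C zero t with C zero
... | true = ≡.cong suc (count-cong (λ i → ≡.sym (BoolP.∧-identityʳ (C (suc i)))))
count-remove {suc n} C (suc j) t with C zero
... | true = ≡.cong suc (≡.trans (count-remove (λ i → C (suc i)) j t) (≡.cong suc tails))
  where tails = count-cong (λ i → ≡.cong (λ b → C (suc i) ∧ not b) (≡.sym (⌊suc≟suc⌋ i j)))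
... | false = ≡.trans (count-remove (λ i → C (suc i)) j t) (≡.cong suc tails)
  where tails = count-cong (λ i → ≡.cong (λ b → C (suc i) ∧ not b) (≡.sym (⌊suc≟suc⌋ i j)))

count-insert : ∀ {n} (C : Subset (Fin n)) j → ¬ T (C j) → count (λ i → C i ∨ ⌊ i ≟ j ⌋) ≡ suc (count C)
count-insert C j j∉C = ≡.trans (count-remove (λ i → C i ∨ ⌊ i ≟ j ⌋) j (∨-introʳ (C j) (⌊⌋-refl j)))
  (≡.cong suc (count-cong λ i → remove-inserted (C i) (i ≟ j) (λ { ≡.refl → j∉C })))
  where
  remove-inserted : ∀ b {i} (d : Dec (i ≡ j)) → (i ≡ j → ¬ T b) → (b ∨ ⌊ d ⌋) ∧ not ⌊ d ⌋ ≡ b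
  remove-inserted true (yes i≡j) h = ⊥-elim (h i≡j tt)
  remove-inserted false (yes _) h = ≡.refl
  remove-inserted true (no _) h = ≡.refl
  remove-inserted false (no _) h = ≡.refl

record Enumeration {a} {A : Set a} (S : Subset A) (p : ℕ) : Set a where
  field
    elem : Fin p → A
    injective : ∀ x y → elem x ≡ elem y → x ≡ y
    into : ∀ x → elem x ∈ S
    onto : ∀ e → e ∈ S → ∃ λ x → elem x ≡ e

  outside : ∀ e → ¬ e ∈ S → ∀ x → elem x ≢ e
  outside e e∉S x eq = e∉S (≡.subst (_∈ S) eq (into x))

enumerateFin : ∀ {n} (S : Subset (Fin n)) → Enumeration S (count S)
enumerateFin {zero} S = record { elem = λ () ; injective = λ () ; into = λ () ; onto = λ () }
enumerateFin {suc n} S = go (S zero) ≡.refl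
  where
  module R = Enumeration (enumerateFin (λ i → S (suc i)))
  go : (b : Bool) → b ≡ S zero → Enumeration S ((if b then 1 else 0) ℕ.+ count (λ i → S (suc i)))
  go true eq = record
    { elem = λ { zero → zero ; (suc x) → suc (R.elem x) }
    ; injective = λ { zero zero _ → ≡.refl ; zero (suc y) () ; (suc x) zero ()
                    ; (suc x) (suc y) e → ≡.cong suc (R.injective x y (FinP.suc-injective e)) }
    ; into = λ { zero → ≡true⇒T (≡.sym eq) ; (suc x) → R.into x }
    ; onto = λ { zero _ → zero , ≡.refl ; (suc i) t → case R.onto i t of λ { (x , e) → suc x , ≡.cong suc e } } }
  go false eq = record
    { elem = λ x → suc (R.elem x)
    ; injective = λ x y e → R.injective x y (FinP.suc-injective e)
    ; into = R.into
    ; onto = λ { zero t → ⊥-elim (≡.subst T (≡.sym eq) t) ; (suc i) t → case R.onto i t of λ { (x , e) → x , ≡.cong suc e } } }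

countG : ∀ {m n} → Subset (Ground m n) → ℕ
countG S = count (λ i → S (inj₁ i)) ℕ.+ count (λ j → S (inj₂ j))

enumerate : ∀ {m n} (S : Subset (Ground m n)) → Enumeration S (countG S)
enumerate {m} {n} S = record { elem = elem ; injective = injective ; into = into ; onto = onto }
  where
  p₁ = count (λ i → S (inj₁ i))
  p₂ = count (λ j → S (inj₂ j))
  module E₁ = Enumeration (enumerateFin (λ i → S (inj₁ i)))
  module E₂ = Enumeration (enumerateFin (λ j → S (inj₂ j)))
  elem⊎ : Fin p₁ ⊎ Fin p₂ → Ground m n
  elem⊎ (inj₁ x) = inj₁ (E₁.elem x)
  elem⊎ (inj₂ y) = inj₂ (E₂.elem y)
  elem : Fin (p₁ ℕ.+ p₂) → Ground m n
  elem x = elem⊎ (Fin.splitAt p₁ x)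
  elem⊎-injective : ∀ x y → elem⊎ x ≡ elem⊎ y → x ≡ y
  elem⊎-injective (inj₁ x) (inj₁ y) e = ≡.cong inj₁ (E₁.injective x y (SumP.inj₁-injective e))
  elem⊎-injective (inj₂ x) (inj₂ y) e = ≡.cong inj₂ (E₂.injective x y (SumP.inj₂-injective e))
  elem⊎-injective (inj₁ x) (inj₂ y) ()
  elem⊎-injective (inj₂ x) (inj₁ y) ()
  injective : ∀ x y → elem x ≡ elem y → x ≡ y
  injective x y e = ≡.trans (≡.sym (FinP.join-splitAt p₁ p₂ x))
    (≡.trans (≡.cong (Fin.join p₁ p₂) (elem⊎-injective _ _ e)) (FinP.join-splitAt p₁ p₂ y))
  into⊎ : ∀ x → elem⊎ x ∈ S
  into⊎ (inj₁ x) = E₁.into x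
  into⊎ (inj₂ y) = E₂.into y
  into : ∀ x → elem x ∈ S
  into x = into⊎ (Fin.splitAt p₁ x)
  onto : ∀ e → e ∈ S → ∃ λ x → elem x ≡ e
  onto (inj₁ i) t = case E₁.onto i t of λ where
    (x , e) → (x Fin.↑ˡ p₂) , ≡.trans (≡.cong elem⊎ (FinP.splitAt-↑ˡ p₁ x p₂)) (≡.cong inj₁ e)
  onto (inj₂ j) t = case E₂.onto j t of λ where
    (y , e) → (p₁ Fin.↑ʳ y) , ≡.trans (≡.cong elem⊎ (FinP.splitAt-↑ʳ p₁ p₂ y)) (≡.cong inj₂ e)

-- insert of Defs on the ground set (it does not depend on the independence predicate)
insertG : ∀ {m n} → Ground m n → Subset (Ground m n) → Subset (Ground m n)
insertG = MatroidNotions.insert _≟G_ (λ _ → ⊤)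

prepend : ∀ {p} {X : Set} → X → (Fin p → X) → Fin (suc p) → X
prepend x f zero = x
prepend x f (suc c) = f c

enumerate-insert : ∀ {m n} {S : Subset (Ground m n)} {p} e → Enumeration S p → ¬ e ∈ S →
                   Enumeration (insertG e S) (suc p)
enumerate-insert {S = S} e E e∉S = record { elem = prepend e elem ; injective = injective' ; into = into' ; onto = onto' }
  where
  open Enumeration E
  injective' : ∀ x y → prepend e elem x ≡ prepend e elem y → x ≡ y
  injective' zero zero _ = ≡.refl
  injective' zero (suc y) eq = ⊥-elim (outside e e∉S y (≡.sym eq))
  injective' (suc x) zero eq = ⊥-elim (outside e e∉S x eq)
  injective' (suc x) (suc y) eq = ≡.cong suc (injective x y eq)
  into' : ∀ x → prepend e elem x ∈ insertG e S
  into' zero = ∨-introˡ {⌊ e ≟G e ⌋} (fromWitness ≡.refl)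
  into' (suc x) = ∨-introʳ ⌊ elem x ≟G e ⌋ (into x)
  onto' : ∀ x → x ∈ insertG e S → ∃ λ y → prepend e elem y ≡ x
  onto' x t with x ≟G e
  ... | yes x≡e = zero , ≡.sym x≡e
  ... | no _ = case onto x t of λ where
    (y , eq) → suc y , eq

module ColumnMatroid {f ℓ} (F : Field f ℓ) where
  open Field F hiding (zero)
  open FieldFacts F
  open Determinant F
  open ColumnIndependence F

  columnsOf : ∀ {m n p} → Matrix m n → (Fin p → Ground m n) → Matrix m p
  columnsOf A g r x = col A (g x) r

  pointAt : ∀ {A : Set} → DecidableEquality A → A → A → Carrier → Carrier
  pointAt _≟A_ x y a = if ⌊ x ≟A y ⌋ then a else 0#

  pointAt-≡ : ∀ {A : Set} (_≟A_ : DecidableEquality A) x y a → x ≡ y → pointAt _≟A_ x y a ≈ a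
  pointAt-≡ _≟A_ x y a x≡y with x ≟A y
  ... | yes _ = refl
  ... | no x≢y = ⊥-elim (x≢y x≡y)

  pointAt-≢ : ∀ {A : Set} (_≟A_ : DecidableEquality A) x y a → x ≢ y → pointAt _≟A_ x y a ≈ 0#
  pointAt-≢ _≟A_ x y a x≢y with x ≟A y
  ... | yes x≡y = ⊥-elim (x≢y x≡y)
  ... | no _ = refl

  module _ {m n} {S : Subset (Ground m n)} {p} (E : Enumeration S p) where
    open Enumeration E

    ∑G-enumerate : (h : Ground m n → Carrier) → (∀ e → ¬ e ∈ S → h e ≈ 0#) → ∑G h ≈ ∑ (λ x → h (elem x))
    ∑G-enumerate h h≈0 = begin
      ∑G h                                                      ≈⟨ ∑G-cong spread ⟩
      ∑G (λ e → ∑ (λ x → pointAt _≟G_ (elem x) e (h (elem x)))) ≈⟨ ∑G-swap (λ e x → pointAt _≟G_ (elem x) e (h (elem x))) ⟩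
      ∑ (λ x → ∑G (λ e → pointAt _≟G_ (elem x) e (h (elem x))))
        ≈⟨ ∑-cong (λ x → trans (∑G-single (λ e → pointAt _≟G_ (elem x) e (h (elem x))) (elem x)
                                          (λ e e≢ → pointAt-≢ _≟G_ (elem x) e _ (λ eq → e≢ (≡.sym eq))))
                               (pointAt-≡ _≟G_ (elem x) (elem x) _ ≡.refl)) ⟩
      ∑ (λ x → h (elem x))                                      ∎
      where
      spread : ∀ e → h e ≈ ∑ (λ x → pointAt _≟G_ (elem x) e (h (elem x)))
      spread e with T? (S e)
      ... | no e∉S = trans (h≈0 e e∉S) (sym (∑-zero (λ x → pointAt-≢ _≟G_ (elem x) e _ (outside e e∉S x))))
      ... | yes e∈S with onto e e∈S
      ...   | (x₀ , eq) = sym (trans (∑-single _ x₀ (λ x x≢x₀ → pointAt-≢ _≟G_ (elem x) e _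
                                                      (λ eq' → x≢x₀ (injective x x₀ (≡.trans eq' (≡.sym eq))))))
                                     (trans (pointAt-≡ _≟G_ (elem x₀) e _ eq) (reflexive (≡.cong h eq))))

    independent⇒columnsIndependent : (A : Matrix m n) → IndepIA A S → ColumnsIndependent (columnsOf A elem)
    independent⇒columnsIndependent A ind a rel x = begin
      a x           ≈⟨ sym (coef-elem x) ⟩
      coef (elem x) ≈⟨ ind coef coef-outside relG (elem x) (into x) ⟩
      0#            ∎
      where
      coef : Ground m n → Carrier
      coef e = ∑ (λ x → pointAt _≟G_ (elem x) e (a x))
      coef-elem : ∀ x₀ → coef (elem x₀) ≈ a x₀
      coef-elem x₀ = trans (∑-single _ x₀ (λ x x≢x₀ → pointAt-≢ _≟G_ (elem x) (elem x₀) _ (λ eq → x≢x₀ (injective x x₀ eq))))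
                           (pointAt-≡ _≟G_ (elem x₀) (elem x₀) _ ≡.refl)
      coef-outside : ∀ e → ¬ e ∈ S → coef e ≈ 0#
      coef-outside e e∉S = ∑-zero (λ x → pointAt-≢ _≟G_ (elem x) e _ (outside e e∉S x))
      relG : ∀ k → ∑G (λ e → coef e * col A e k) ≈ 0#
      relG k = begin
        ∑G (λ e → coef e * col A e k)
          ≈⟨ ∑G-enumerate (λ e → coef e * col A e k) (λ e e∉S → trans (*-congʳ (coef-outside e e∉S)) (zeroˡ _)) ⟩
        ∑ (λ x → coef (elem x) * col A (elem x) k) ≈⟨ ∑-cong (λ x → *-congʳ (coef-elem x)) ⟩
        ∑ (λ x → a x * columnsOf A elem k x)      ≈⟨ rel k ⟩
        0#                                       ∎

    columnsIndependent⇒independent : (A : Matrix m n) → ColumnsIndependent (columnsOf A elem) → IndepIA A S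
    columnsIndependent⇒independent A ind coef coef-outside rel e e∈S with onto e e∈S
    ... | (x , ≡.refl) = ind (λ x → coef (elem x)) rel' x
      where
      rel' : ∀ k → ∑ (λ x → coef (elem x) * columnsOf A elem k x) ≈ 0#
      rel' k = trans (sym (∑G-enumerate (λ e → coef e * col A e k) (λ e e∉S → trans (*-congʳ (coef-outside e e∉S)) (zeroˡ _)))) (rel k)

  repeated-column⇒dependent : ∀ {k p} (M : Matrix k p) c₁ c₂ → c₁ ≢ c₂ → (∀ r → M r c₁ ≈ M r c₂) → ¬ ColumnsIndependent M
  repeated-column⇒dependent M c₁ c₂ c₁≢c₂ same ind = 0≉1 (sym (trans (sym a-c₁) (ind a rel c₁)))
    where
    a : Fin _ → Carrier
    a x = pointAt _≟_ x c₁ 1# - pointAt _≟_ x c₂ 1#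
    a-c₁ : a c₁ ≈ 1#
    a-c₁ = trans (+-cong (pointAt-≡ _≟_ c₁ c₁ 1# ≡.refl) (-‿cong (pointAt-≢ _≟_ c₁ c₂ 1# c₁≢c₂)))
                 (trans (+-congˡ -0#≈0#) (+-identityʳ _))
    pick : ∀ r c → ∑ (λ x → pointAt _≟_ x c 1# * M r x) ≈ M r c
    pick r c = trans (∑-single _ c (λ x x≢c → trans (*-congʳ (pointAt-≢ _≟_ x c 1# x≢c)) (zeroˡ _)))
                     (trans (*-congʳ (pointAt-≡ _≟_ c c 1# ≡.refl)) (*-identityˡ _))
    rel : ∀ r → ∑ (λ x → a x * M r x) ≈ 0#
    rel r = begin
      ∑ (λ x → a x * M r x)
        ≈⟨ ∑-cong (λ x → solve 3 (λ u v w → (u :+ :- v) :* w := u :* w :+ :- (v :* w))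
                                 refl (pointAt _≟_ x c₁ 1#) (pointAt _≟_ x c₂ 1#) (M r x)) ⟩
      ∑ (λ x → pointAt _≟_ x c₁ 1# * M r x + - (pointAt _≟_ x c₂ 1# * M r x))
        ≈⟨ ∑-+ (λ x → pointAt _≟_ x c₁ 1# * M r x) (λ x → - (pointAt _≟_ x c₂ 1# * M r x)) ⟩
      ∑ (λ x → pointAt _≟_ x c₁ 1# * M r x) + ∑ (λ x → - (pointAt _≟_ x c₂ 1# * M r x))
        ≈⟨ +-cong (pick r c₁) (trans (∑-neg (λ x → pointAt _≟_ x c₂ 1# * M r x)) (-‿cong (pick r c₂))) ⟩
      M r c₁ - M r c₂   ≈⟨ +-congˡ (-‿cong (sym (same r))) ⟩
      M r c₁ - M r c₁   ≈⟨ -‿inverseʳ _ ⟩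
      0#                ∎

  independent-size≤m : ∀ {m n} (A : Matrix m n) {S : Subset (Ground m n)} {p} → Enumeration S p → IndepIA A S → p ≤ m
  independent-size≤m {m} A {p = p} E ind with p ℕP.≤? m
  ... | yes p≤m = p≤m
  ... | no p≰m = ⊥-elim (more-columns-than-rows⇒dependent m p (ℕP.≰⇒> p≰m) (columnsOf A (Enumeration.elem E))
                           (independent⇒columnsIndependent E A ind))

  -- a maximal independent set has at least m elements: otherwise some unit
  -- column e_i (the element i ∈ S₁) could be added
  maximal-size≥m : ∀ {m n} (A : Matrix m n) {S : Subset (Ground m n)} {p} → Enumeration S p → IndepIA A S →
                   (∀ e → ¬ e ∈ S → ¬ IndepIA A (insertG e S)) → m ≤ p
  maximal-size≥m {m} A {S} {p} E ind maximal = decidable-stable (m ℕP.≤? p) λ m≰p →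
    extend-by-unitVector m p (ℕP.≰⇒> m≰p) (columnsOf A elem) (independent⇒columnsIndependent E A ind) λ where
      (i , ind') → i∉S i ind' λ i∉S →
        maximal (inj₁ i) i∉S (columnsIndependent⇒independent (enumerate-insert (inj₁ i) E i∉S) A
                                (ColumnsIndependent-cong (same-columns i) ind'))
    where
    open Enumeration E
    same-columns : ∀ i r c → addUnitColumn i (columnsOf A elem) r c ≈ columnsOf A (prepend (inj₁ i) elem) r c
    same-columns i r zero = refl
    same-columns i r (suc c) = refl
    -- e_i is not already a column of the set, since the columns stay independent
    i∉S : ∀ i → ColumnsIndependent (addUnitColumn i (columnsOf A elem)) → ¬¬ (¬ inj₁ i ∈ S)
    i∉S i ind' k = k λ i∈S → case onto (inj₁ i) i∈S of λ where
      (x , eq) → repeated-column⇒dependent (addUnitColumn i (columnsOf A elem)) zero (suc x) (λ ())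
                   (λ r → reflexive (≡.cong (λ e → col A e r) (≡.sym eq))) ind'

  size-m⇒maximal : ∀ {m n} (A : Matrix m n) {S : Subset (Ground m n)} → Enumeration S m →
                   ∀ e → ¬ e ∈ S → ¬ IndepIA A (insertG e S)
  size-m⇒maximal A E e e∉S ind = ℕP.<-irrefl ≡.refl (independent-size≤m A (enumerate-insert e E e∉S) ind)

  basis-size : ∀ {m n} (A : Matrix m n) {B : Subset (Ground m n)} → MatroidNotions.IsBasis _≟G_ (IndepIA A) B → countG B ≡ m
  basis-size A {B} (ind , maximal) = ℕP.≤-antisym (independent-size≤m A (enumerate B) ind) (maximal-size≥m A (enumerate B) ind maximal)

  enumerate-basis : ∀ {m n} (A : Matrix m n) {B : Subset (Ground m n)} → MatroidNotions.IsBasis _≟G_ (IndepIA A) B → Enumeration B m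
  enumerate-basis A {B} basis = ≡.subst (Enumeration B) (basis-size A basis) (enumerate B)

  row-[I,A] : ∀ {m n} (A : Matrix m n) (coef : Ground m n → Carrier) k →
              ∑G (λ e → coef e * col A e k) ≈ coef (inj₁ k) + ∑ (λ j → coef (inj₂ j) * A k j)
  row-[I,A] A coef k = +-congʳ (trans (∑-single _ k (λ i i≢k → trans (*-congˡ (off-diagonal i i≢k)) (zeroʳ _)))
                                      (trans (*-congˡ diagonal) (*-identityʳ _)))
    where
    off-diagonal : ∀ i → i ≢ k → col A (inj₁ i) k ≈ 0#
    off-diagonal i i≢k with i ≟ k
    ... | yes i≡k = ⊥-elim (i≢k i≡k)
    ... | no _ = refl
    diagonal : col A (inj₁ k) k ≈ 1#
    diagonal with k ≟ k
    ... | yes _ = refl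
    ... | no k≢k = ⊥-elim (k≢k ≡.refl)

  independent-⊆ : ∀ {m n} (A : Matrix m n) {S S' : Subset (Ground m n)} → S' ⊆ S → IndepIA A S → IndepIA A S'
  independent-⊆ A S'⊆S ind coef outside rel e e∈S' = ind coef (λ e e∉S → outside e (λ e∈S' → e∉S (S'⊆S e e∈S'))) rel e (S'⊆S e e∈S')

  complementRows : ∀ {m n} → Subset (Ground m n) → Subset (Fin n) → Subset (Ground m n)
  complementRows Z D (inj₁ i) = not (Z (inj₁ i))
  complementRows Z D (inj₂ j) = D j

  submatrix⇒independent : ∀ {m n} (A : Matrix m n) Z D → IndepColsSub A Z D → IndepIA A (complementRows Z D)
  submatrix⇒independent {m} {n} A Z D ind coef outside rel = coef≈0
    where
    row : ∀ k → coef (inj₁ k) + ∑ (λ j → coef (inj₂ j) * A k j) ≈ 0#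
    row k = trans (sym (row-[I,A] A coef k)) (rel k)
    column-coef≈0 : ∀ j → j ∈ D → coef (inj₂ j) ≈ 0#
    column-coef≈0 = ind (λ j → coef (inj₂ j)) (λ j j∉D → outside (inj₂ j) j∉D)
      (λ i i∈Z → trans (sym (+-identityˡ _)) (trans (+-congʳ (sym (outside (inj₁ i) (λ t → not-elim t i∈Z)))) (row i)))
    column-coef≈0' : ∀ j → coef (inj₂ j) ≈ 0#
    column-coef≈0' j with T? (D j)
    ... | yes j∈D = column-coef≈0 j j∈D
    ... | no j∉D = outside (inj₂ j) j∉D
    coef≈0 : ∀ e → e ∈ complementRows Z D → coef e ≈ 0#
    coef≈0 (inj₂ j) j∈D = column-coef≈0 j j∈D
    coef≈0 (inj₁ i) _ = begin
      coef (inj₁ i)                                   ≈⟨ sym (+-identityʳ _) ⟩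
      coef (inj₁ i) + 0#                              ≈⟨ +-congˡ (sym (∑-zero (λ j → trans (*-congʳ (column-coef≈0' j)) (zeroˡ _)))) ⟩
      coef (inj₁ i) + ∑ (λ j → coef (inj₂ j) * A i j) ≈⟨ row i ⟩
      0#                                              ∎

  independent⇒submatrix : ∀ {m n} (A : Matrix m n) Z D → IndepIA A (complementRows Z D) → IndepColsSub A Z D
  independent⇒submatrix {m} {n} A Z D ind coef outside rel j j∈D = ind coef' outside' rel' (inj₂ j) j∈D
    where
    rowSum : Fin m → Carrier
    rowSum i = ∑ (λ j → coef j * A i j)
    -- the unit columns of the rows outside Z cancel the remaining row sums
    coef' : Ground m n → Carrier
    coef' (inj₁ i) = if Z (inj₁ i) then 0# else - rowSum i
    coef' (inj₂ j) = coef j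
    outside' : ∀ e → ¬ e ∈ complementRows Z D → coef' e ≈ 0#
    outside' (inj₂ j) j∉D = outside j j∉D
    outside' (inj₁ i) i∉ with Z (inj₁ i)
    ... | true = refl
    ... | false = ⊥-elim (i∉ tt)
    rel' : ∀ k → ∑G (λ e → coef' e * col A e k) ≈ 0#
    rel' k = trans (row-[I,A] A coef' k) (by-row (Z (inj₁ k)) ≡.refl)
      where
      by-row : ∀ b → b ≡ Z (inj₁ k) → (if b then 0# else - rowSum k) + rowSum k ≈ 0#
      by-row true eq = trans (+-identityˡ _) (rel k (≡true⇒T (≡.sym eq)))
      by-row false eq = trans (+-comm _ _) (-‿inverseʳ _)

module BasesOfColumnMatroid {f ℓ} (F : Field f ℓ) where
  open Field F hiding (zero)
  open FieldFacts F
  open Determinant F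
  open ColumnIndependence F
  open ColumnMatroid F

  S₁ : ∀ {m n} → Subset (Ground m n)
  S₁ (inj₁ _) = true
  S₁ (inj₂ _) = false

  enumerateS₁ : ∀ {m n} → Enumeration (S₁ {m} {n}) m
  enumerateS₁ = record { elem = inj₁ ; injective = λ x y → SumP.inj₁-injective ; into = λ _ → tt
                       ; onto = λ { (inj₁ i) _ → i , ≡.refl } }

  enumerateHyp : ∀ {m n} (i : Fin m) (j : Fin n) → Enumeration (hyp i j) m
  enumerateHyp {m} {n} i j = record { elem = elem ; injective = injective ; into = into ; onto = onto }
    where
    elem : Fin m → Ground m n
    elem = updateAt inj₁ i (λ _ → inj₂ j)
    elem-i : elem i ≡ inj₂ j
    elem-i = VecFP.updateAt-updates i inj₁
    elem-other : ∀ k → k ≢ i → elem k ≡ inj₁ k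
    elem-other k k≢i = VecFP.updateAt-minimal k i inj₁ k≢i
    injective : ∀ x y → elem x ≡ elem y → x ≡ y
    injective x y eq = case (x ≟ i) , (y ≟ i) of λ where
      (yes x≡i , yes y≡i) → ≡.trans x≡i (≡.sym y≡i)
      (yes ≡.refl , no y≢i) → case ≡.trans (≡.sym elem-i) (≡.trans eq (elem-other y y≢i)) of λ ()
      (no x≢i , yes ≡.refl) → case ≡.trans (≡.sym elem-i) (≡.trans (≡.sym eq) (elem-other x x≢i)) of λ ()
      (no x≢i , no y≢i) → SumP.inj₁-injective (≡.trans (≡.sym (elem-other x x≢i)) (≡.trans eq (elem-other y y≢i)))
    into : ∀ x → elem x ∈ hyp i j
    into x = case x ≟ i of λ where
      (yes ≡.refl) → ≡.subst (_∈ hyp i j) (≡.sym elem-i) (⌊⌋-refl j)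
      (no x≢i) → ≡.subst (_∈ hyp i j) (≡.sym (elem-other x x≢i)) (not-intro (⌊⌋-no (x ≟ i) x≢i))
    onto : ∀ e → e ∈ hyp i j → ∃ λ x → elem x ≡ e
    onto (inj₁ k) k≢i = k , elem-other k (λ k≡i → not-elim k≢i (fromWitness k≡i))
    onto (inj₂ j') j'≡j = i , ≡.trans elem-i (≡.cong inj₂ (≡.sym (toWitness j'≡j)))

  module _ {m n} (A : Matrix m n) where

    zero-submatrix⇒rank0 : ∀ Z → (∀ r j → inj₁ r ∈ Z → inj₂ j ∈ Z → A r j ≈ 0#) → HasRank A Z 0
    zero-submatrix⇒rank0 Z A[Z]≈0 = ((λ _ → false) , (λ j ()) , count-empty {n} , (λ coef out rel j ())) , no-column
      where
      no-column : ¬ RankAtLeast A Z 1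
      no-column (D , D⊆Z , |D|≡1 , ind) with count-nonempty D |D|≡1
      ... | (j₀ , j₀∈D) = 0≉1 (sym (trans (sym (pointAt-≡ _≟_ j₀ j₀ 1# ≡.refl)) (ind coef outside rel j₀ j₀∈D)))
        where
        coef : Fin n → Carrier
        coef j = pointAt _≟_ j j₀ 1#
        outside : ∀ j → ¬ j ∈ D → coef j ≈ 0#
        outside j j∉D = pointAt-≢ _≟_ j j₀ 1# (λ { ≡.refl → j∉D j₀∈D })
        rel : ∀ i → inj₁ i ∈ Z → ∑ (λ j → coef j * A i j) ≈ 0#
        rel i i∈Z = trans (∑-single _ j₀ (λ j j≢j₀ → trans (*-congʳ (pointAt-≢ _≟_ j j₀ 1# j≢j₀)) (zeroˡ _)))
                          (trans (*-congʳ (pointAt-≡ _≟_ j₀ j₀ 1# ≡.refl)) (trans (*-identityˡ _) (A[Z]≈0 i j₀ i∈Z (D⊆Z j₀ j₀∈D))))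

    single-column-sum : ∀ (coef : Fin n → Carrier) j → (∀ j' → j' ≢ j → coef j' ≈ 0#) →
                        ∀ k → ∑ (λ j' → coef j' * A k j') ≈ coef j * A k j
    single-column-sum coef j others≈0 k = ∑-single _ j (λ j' j'≢j → trans (*-congʳ (others≈0 j' j'≢j)) (zeroˡ _))

    hyp-independent : ∀ i j → ¬ (A i j ≈ 0#) → IndepIA A (hyp i j)
    hyp-independent i j Aᵢⱼ≉0 coef outside rel = coef≈0
      where
      row : ∀ k → coef (inj₁ k) + coef (inj₂ j) * A k j ≈ 0#
      row k = trans (+-congˡ (sym (single-column-sum (λ j' → coef (inj₂ j')) j
                                     (λ j' j'≢j → outside (inj₂ j') (⌊⌋-no (j' ≟ j) j'≢j)) k)))
                    (trans (sym (row-[I,A] A coef k)) (rel k))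
      coef-i≈0 : coef (inj₁ i) ≈ 0#
      coef-i≈0 = outside (inj₁ i) (λ t → not-elim t (⌊⌋-refl i))
      coef-j≈0 : coef (inj₂ j) ≈ 0#
      coef-j≈0 = cancel-nonzero Aᵢⱼ≉0 (trans (*-comm _ _) (trans (sym (+-identityˡ _)) (trans (+-congʳ (sym coef-i≈0)) (row i))))
      coef≈0 : ∀ e → e ∈ hyp i j → coef e ≈ 0#
      coef≈0 (inj₂ j') j'≡j = trans (reflexive (≡.cong (λ z → coef (inj₂ z)) (toWitness j'≡j))) coef-j≈0
      coef≈0 (inj₁ k) _ = trans (sym (+-identityʳ _)) (trans (+-congˡ (sym (trans (*-congʳ coef-j≈0) (zeroˡ _)))) (row k))

    S₁-independent : IndepIA A S₁
    S₁-independent coef outside rel (inj₁ k) _ =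
      trans (sym (+-identityʳ _)) (trans (+-congˡ (sym (∑-zero (λ j → trans (*-congʳ (outside (inj₂ j) (λ ()))) (zeroˡ _)))))
            (trans (sym (row-[I,A] A coef k)) (rel k)))

    module Fragile (c : Fin m) (d : Fin n) (fragile : Fragile A (pair c d)) where
      open MatroidNotions {E = Ground m n} _≟G_ (IndepIA A)

      H : Subset (Ground m n)
      H = hyp c d

      A[c,d]≈0 : A c d ≈ 0#
      A[c,d]≈0 = proj₁ fragile c d (⌊⌋-refl c) (⌊⌋-refl d)

      -- for Y ≠ ∅ disjoint from {c, d}, A[{c, d} ∪ Y] is not a zero matrix,
      -- since then both A[{c, d} ∪ Y] and A[Y] would have rank 0
      fragile-nonzero : ∀ Y → (∃ λ e → e ∈ Y) → (∀ e → e ∈ Y → ¬ e ∈ pair c d) →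
                        ¬ (∀ r j → inj₁ r ∈ (pair c d ∪ Y) → inj₂ j ∈ (pair c d ∪ Y) → A r j ≈ 0#)
      fragile-nonzero Y Y≠∅ disjoint A[X∪Y]≈0 = ℕP.<-irrefl ≡.refl (proj₂ fragile Y Y≠∅ disjoint 0 0
        (zero-submatrix⇒rank0 (pair c d ∪ Y) A[X∪Y]≈0)
        (zero-submatrix⇒rank0 Y (λ r j r∈Y j∈Y → A[X∪Y]≈0 r j (∨-introʳ (pair c d (inj₁ r)) r∈Y) (∨-introʳ (pair c d (inj₂ j)) j∈Y))))

      -- column d has no zero entry outside row c (take Y = {i})
      column-d-nonzero : ∀ i → i ≢ c → ¬ (A i d ≈ 0#)
      column-d-nonzero i i≢c A[i,d]≈0 = fragile-nonzero Y (inj₁ i , ⌊⌋-refl i) disjoint A[X∪Y]≈0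
        where
        Y : Subset (Ground m n)
        Y (inj₁ i') = ⌊ i' ≟ i ⌋
        Y (inj₂ _) = false
        disjoint : ∀ e → e ∈ Y → ¬ e ∈ pair c d
        disjoint (inj₁ i') i'≡i i'≡c = i≢c (≡.trans (≡.sym (toWitness i'≡i)) (toWitness i'≡c))
        A[X∪Y]≈0 : ∀ r j → inj₁ r ∈ (pair c d ∪ Y) → inj₂ j ∈ (pair c d ∪ Y) → A r j ≈ 0#
        A[X∪Y]≈0 r j r∈ j∈ with ∨-elim ⌊ j ≟ d ⌋ j∈
        ... | inj₂ ()
        ... | inj₁ j≡d with toWitness j≡d | ∨-elim ⌊ r ≟ c ⌋ r∈
        ...   | ≡.refl | inj₁ r≡c = trans (reflexive (≡.cong (λ r → A r j) (toWitness r≡c))) A[c,d]≈0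
        ...   | ≡.refl | inj₂ r≡i = trans (reflexive (≡.cong (λ r → A r j) (toWitness r≡i))) A[i,d]≈0

      -- row c has no zero entry outside column d (take Y = {j})
      row-c-nonzero : ∀ j → j ≢ d → ¬ (A c j ≈ 0#)
      row-c-nonzero j j≢d A[c,j]≈0 = fragile-nonzero Y (inj₂ j , ⌊⌋-refl j) disjoint A[X∪Y]≈0
        where
        Y : Subset (Ground m n)
        Y (inj₁ _) = false
        Y (inj₂ j') = ⌊ j' ≟ j ⌋
        disjoint : ∀ e → e ∈ Y → ¬ e ∈ pair c d
        disjoint (inj₂ j') j'≡j j'≡d = j≢d (≡.trans (≡.sym (toWitness j'≡j)) (toWitness j'≡d))
        A[X∪Y]≈0 : ∀ r j' → inj₁ r ∈ (pair c d ∪ Y) → inj₂ j' ∈ (pair c d ∪ Y) → A r j' ≈ 0#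
        A[X∪Y]≈0 r j' r∈ j'∈ with ∨-elim ⌊ r ≟ c ⌋ r∈
        ... | inj₂ ()
        ... | inj₁ r≡c with toWitness r≡c | ∨-elim ⌊ j' ≟ d ⌋ j'∈
        ...   | ≡.refl | inj₁ j'≡d = trans (reflexive (≡.cong (A r) (toWitness j'≡d))) A[c,d]≈0
        ...   | ≡.refl | inj₂ j'≡j = trans (reflexive (≡.cong (A r) (toWitness j'≡j))) A[c,j]≈0

      -- H is dependent: column d equals ∑ᵢ A i d · e_i, as A c d = 0
      H-dependent : ¬ IndepIA A H
      H-dependent ind = 0≉1 (sym (trans (sym (pointAt-≡ _≟_ d d 1# ≡.refl)) (ind coef outside rel (inj₂ d) (⌊⌋-refl d))))
        where
        coef : Ground m n → Carrier
        coef (inj₁ i) = - A i d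
        coef (inj₂ j) = pointAt _≟_ j d 1#
        outside : ∀ e → ¬ e ∈ H → coef e ≈ 0#
        outside (inj₁ i) i∉H = trans (-‿cong (trans (reflexive (≡.cong (λ r → A r d) (toWitness (not-not i∉H)))) A[c,d]≈0)) -0#≈0#
        outside (inj₂ j) j∉H = pointAt-≢ _≟_ j d 1# (λ j≡d → j∉H (fromWitness j≡d))
        rel : ∀ k → ∑G (λ e → coef e * col A e k) ≈ 0#
        rel k = begin
          ∑G (λ e → coef e * col A e k)                      ≈⟨ row-[I,A] A coef k ⟩
          - A k d + ∑ (λ j → pointAt _≟_ j d 1# * A k j)
            ≈⟨ +-congˡ (single-column-sum (λ j → pointAt _≟_ j d 1#) d (λ j j≢d → pointAt-≢ _≟_ j d 1# j≢d) k) ⟩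
          - A k d + pointAt _≟_ d d 1# * A k d               ≈⟨ +-congˡ (trans (*-congʳ (pointAt-≡ _≟_ d d 1# ≡.refl)) (*-identityˡ _)) ⟩
          - A k d + A k d                                    ≈⟨ -‿inverseˡ _ ⟩
          0#                                                 ∎

      H-circuit : IsCircuit H
      H-circuit = H-dependent , remove-independent
        where
        remove-independent : ∀ e → e ∈ H → IndepIA A (remove e H)
        remove-independent (inj₁ i) i∈H = independent-⊆ A ⊆hyp (hyp-independent i d (column-d-nonzero i i≢c))
          where
          i≢c : i ≢ c
          i≢c i≡c = not-elim i∈H (fromWitness i≡c)
          ⊆hyp : remove (inj₁ i) H ⊆ hyp i d
          ⊆hyp (inj₁ k) t = not-intro (⌊⌋-no (k ≟ i) (λ k≡i →
            not-elim (∧-elimˡ (not ⌊ inj₁ k ≟G inj₁ i ⌋) t) (fromWitness (≡.cong inj₁ k≡i))))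
          ⊆hyp (inj₂ j) t = ∧-elimʳ (not ⌊ inj₂ j ≟G inj₁ i ⌋) t
        remove-independent (inj₂ j) j∈H = independent-⊆ A ⊆S₁ (S₁-independent)
          where
          ⊆S₁ : remove (inj₂ j) H ⊆ S₁
          ⊆S₁ (inj₁ k) _ = tt
          ⊆S₁ (inj₂ j') t = ⊥-elim (not-elim (∧-elimˡ (not ⌊ inj₂ j' ≟G inj₂ j ⌋) t)
            (fromWitness (≡.cong inj₂ (≡.trans (toWitness (∧-elimʳ (not ⌊ inj₂ j' ≟G inj₂ j ⌋) t)) (≡.sym (toWitness j∈H))))))

      c∉H : ¬ inj₁ c ∈ H
      c∉H t = not-elim t (⌊⌋-refl c)

      -- A basis B ⊆ H misses some e ∈ H (H is dependent), and then B + c lies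
      -- in the independent set (S₁ - i) ∪ d (if e = i) or S₁ (if e = d).
      H-not-spanning : ¬ Spanning H
      H-not-spanning (B , (B-independent , B-maximal) , B⊆H) = excluded-middle (∃ λ e → e ∈ H × ¬ e ∈ B) by-cases
        where
        c∉B : ¬ inj₁ c ∈ B
        c∉B c∈B = c∉H (B⊆H _ c∈B)
        i≢c : ∀ i → inj₁ i ∈ H → i ≢ c
        i≢c i i∈H i≡c = not-elim i∈H (fromWitness i≡c)
        B+c⊆hyp : ∀ i → inj₁ i ∈ H → ¬ inj₁ i ∈ B → insertG (inj₁ c) B ⊆ hyp i d
        B+c⊆hyp i i∈H i∉B x t with ∨-elim ⌊ x ≟G inj₁ c ⌋ t
        ... | inj₁ x≡c with toWitness x≡c
        ...   | ≡.refl = not-intro (⌊⌋-no (c ≟ i) (λ c≡i → i≢c i i∈H (≡.sym c≡i)))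
        B+c⊆hyp i i∈H i∉B (inj₁ k) t | inj₂ k∈B = not-intro (⌊⌋-no (k ≟ i) (λ { ≡.refl → i∉B k∈B }))
        B+c⊆hyp i i∈H i∉B (inj₂ j) t | inj₂ j∈B = B⊆H (inj₂ j) j∈B
        B+c⊆S₁ : ∀ j → inj₂ j ∈ H → ¬ inj₂ j ∈ B → insertG (inj₁ c) B ⊆ S₁
        B+c⊆S₁ j j∈H j∉B (inj₁ k) t = tt
        B+c⊆S₁ j j∈H j∉B (inj₂ j') t with ∨-elim ⌊ inj₂ j' ≟G inj₁ c ⌋ t
        ... | inj₁ ()
        ... | inj₂ j'∈B = j∉B (≡.subst (λ z → inj₂ z ∈ B) (≡.trans (toWitness (B⊆H _ j'∈B)) (≡.sym (toWitness j∈H))) j'∈B)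
        by-cases : (∃ λ e → e ∈ H × ¬ e ∈ B) ⊎ ¬ (∃ λ e → e ∈ H × ¬ e ∈ B) → ⊥
        by-cases (inj₂ H⊆B) = H-dependent (independent-⊆ A (λ e e∈H → case T? (B e) of λ where
                                (yes e∈B) → e∈B
                                (no e∉B) → ⊥-elim (H⊆B (e , e∈H , e∉B))) B-independent)
        by-cases (inj₁ (inj₁ i , i∈H , i∉B)) =
          B-maximal (inj₁ c) c∉B (independent-⊆ A (B+c⊆hyp i i∈H i∉B) (hyp-independent i d (column-d-nonzero i (i≢c i i∈H))))
        by-cases (inj₁ (inj₂ j , j∈H , j∉B)) =
          B-maximal (inj₁ c) c∉B (independent-⊆ A (B+c⊆S₁ j j∈H j∉B) S₁-independent)

      -- H + c contains the basis S₁, and H + j (j ≠ d) contains the basis (S₁ - c) ∪ j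
      H+e-spanning : ∀ e → ¬ e ∈ H → Spanning (insert e H)
      H+e-spanning (inj₁ i) i∉H = S₁ , (S₁-independent , size-m⇒maximal A enumerateS₁) , S₁⊆
        where
        S₁⊆ : S₁ ⊆ insert (inj₁ i) H
        S₁⊆ (inj₁ k) _ = case k ≟ c of λ where
          (yes ≡.refl) → ∨-introˡ {⌊ inj₁ k ≟G inj₁ i ⌋} (fromWitness (≡.cong inj₁ (≡.sym (toWitness (not-not i∉H)))))
          (no k≢c) → ∨-introʳ ⌊ inj₁ k ≟G inj₁ i ⌋ (not-intro (⌊⌋-no (k ≟ c) k≢c))
      H+e-spanning (inj₂ j) j∉H = hyp c j , (hyp-independent c j (row-c-nonzero j j≢d) , size-m⇒maximal A (enumerateHyp c j)) , hyp⊆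
        where
        j≢d : j ≢ d
        j≢d j≡d = j∉H (fromWitness j≡d)
        hyp⊆ : hyp c j ⊆ insert (inj₂ j) H
        hyp⊆ (inj₁ k) t = ∨-introʳ ⌊ inj₁ k ≟G inj₂ j ⌋ t
        hyp⊆ (inj₂ j') t = ∨-introˡ {⌊ inj₂ j' ≟G inj₂ j ⌋} (fromWitness (≡.cong inj₂ (toWitness t)))

      H-circuit-hyperplane : IsCircuitHyperplane H
      H-circuit-hyperplane = H-circuit , H-not-spanning , H+e-spanning

      -- Put
      --   Y = (S₁ - B - c) ∪ (B ∩ S₂ - d),  D₀ = B ∩ S₂ - d,  k = |D₀|,
      -- so that B' = B - d + c = (S₁ - Y) ∪ D₀.  Y is nonempty as B ≠ H.  If B'
      -- is independent then rank A[Y] = k (B' is a basis) and rank A[X ∪ Y] ≥ k,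
      -- so by fragility rank A[X ∪ Y] ≥ k + 1, witnessed by the columns B ∩ S₂ of
      -- A[X ∪ Y]; hence (S₁ - X - Y) ∪ (B ∩ S₂) ⊇ B is independent.
      module Exchange (B : Subset (Ground m n)) (E : Enumeration B m) (pos : Fin m)
                      (elem-pos : Enumeration.elem E pos ≡ inj₂ d)
                      (c∉B : ¬ inj₁ c ∈ B) (B≢H : ¬ (B ≐ H)) (|B|≡m : countG B ≡ m) where
        open Enumeration E

        elem' : Fin m → Ground m n
        elem' = updateAt elem pos (λ _ → inj₁ c)

        elem'-pos : ∀ x → x ≡ pos → elem' x ≡ inj₁ c
        elem'-pos x ≡.refl = VecFP.updateAt-updates x elem

        elem'-other : ∀ x → x ≢ pos → elem' x ≡ elem x
        elem'-other x x≢pos = VecFP.updateAt-minimal x pos elem x≢pos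

        B-rows : Subset (Fin m)
        B-rows i = B (inj₁ i)
        B-columns : Subset (Fin n)
        B-columns j = B (inj₂ j)
        D₀ : Subset (Fin n)
        D₀ j = B-columns j ∧ not ⌊ j ≟ d ⌋
        k = count D₀
        Y : Subset (Ground m n)
        Y (inj₁ i) = not (B (inj₁ i)) ∧ not ⌊ i ≟ c ⌋
        Y (inj₂ j) = D₀ j
        X∪Y = pair c d ∪ Y
        B' = complementRows Y D₀

        d∈B : inj₂ d ∈ B
        d∈B = ≡.subst (_∈ B) elem-pos (into pos)

        B'-row : ∀ i → B' (inj₁ i) ≡ B (inj₁ i) ∨ ⌊ i ≟ c ⌋
        B'-row i = de-morgan (B (inj₁ i)) ⌊ i ≟ c ⌋

        B-d⊆B' : ∀ e → e ∈ B → e ≢ inj₂ d → e ∈ B'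
        B-d⊆B' (inj₁ i) i∈B _ = ≡.subst T (≡.sym (B'-row i)) (∨-introˡ i∈B)
        B-d⊆B' (inj₂ j) j∈B j≢d = ∧-intro j∈B (not-intro (⌊⌋-no (j ≟ d) (λ j≡d → j≢d (≡.cong inj₂ j≡d))))

        enumerate-B' : Enumeration B' m
        enumerate-B' = record { elem = elem' ; injective = injective' ; into = into' ; onto = onto' }
          where
          -- c occurs only at position pos, since c ∉ B
          c-only-at-pos : ∀ y → y ≢ pos → elem' y ≢ inj₁ c
          c-only-at-pos y y≢pos eq = c∉B (≡.subst (_∈ B) (≡.trans (≡.sym (elem'-other y y≢pos)) eq) (into y))
          injective' : ∀ x y → elem' x ≡ elem' y → x ≡ y
          injective' x y eq = case (x ≟ pos) , (y ≟ pos) of λ where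
            (yes x≡pos , yes y≡pos) → ≡.trans x≡pos (≡.sym y≡pos)
            (yes x≡pos , no y≢pos) → ⊥-elim (c-only-at-pos y y≢pos (≡.trans (≡.sym eq) (elem'-pos x x≡pos)))
            (no x≢pos , yes y≡pos) → ⊥-elim (c-only-at-pos x x≢pos (≡.trans eq (elem'-pos y y≡pos)))
            (no x≢pos , no y≢pos) → injective x y (≡.trans (≡.sym (elem'-other x x≢pos)) (≡.trans eq (elem'-other y y≢pos)))
          into' : ∀ x → elem' x ∈ B'
          into' x = case x ≟ pos of λ where
            (yes x≡pos) → ≡.subst (_∈ B') (≡.sym (elem'-pos x x≡pos))
                            (≡.subst T (≡.sym (B'-row c)) (∨-introʳ (B (inj₁ c)) (⌊⌋-refl c)))
            (no x≢pos) → ≡.subst (_∈ B') (≡.sym (elem'-other x x≢pos))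
                           (B-d⊆B' (elem x) (into x) (λ eq → x≢pos (injective x pos (≡.trans eq (≡.sym elem-pos)))))
          onto' : ∀ e → e ∈ B' → ∃ λ x → elem' x ≡ e
          onto' (inj₁ i) t with ∨-elim (B (inj₁ i)) (≡.subst T (B'-row i) t)
          ... | inj₂ i≡c = pos , ≡.trans (elem'-pos pos ≡.refl) (≡.cong inj₁ (≡.sym (toWitness i≡c)))
          ... | inj₁ i∈B with onto (inj₁ i) i∈B
          ...   | (x , eq) = x , ≡.trans (elem'-other x (λ { ≡.refl → case ≡.trans (≡.sym elem-pos) eq of λ () })) eq
          onto' (inj₂ j) t with onto (inj₂ j) (∧-elimˡ (B-columns j) t)
          ... | (x , eq) = x , ≡.trans (elem'-other x (λ { ≡.refl → not-elim (∧-elimʳ (B-columns j) t)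
                                   (fromWitness (SumP.inj₂-injective (≡.trans (≡.sym eq) elem-pos))) })) eq

        Y-disjoint : ∀ e → e ∈ Y → ¬ e ∈ pair c d
        Y-disjoint (inj₁ i) t = not-elim (∧-elimʳ (not (B (inj₁ i))) t)
        Y-disjoint (inj₂ j) t = not-elim (∧-elimʳ (B-columns j) t)

        Y-empty⇒B≐H : ¬ (∃ λ e → e ∈ Y) → B ≐ H
        Y-empty⇒B≐H Y≡∅ (inj₁ i) with i ≟ c
        ... | yes ≡.refl = ¬T⇒≡false c∉B
        ... | no i≢c with T? (B (inj₁ i))
        ...   | yes i∈B = T⇒≡true i∈B
        ...   | no i∉B = ⊥-elim (Y≡∅ (inj₁ i , ∧-intro (not-intro i∉B) (not-intro (⌊⌋-no (i ≟ c) i≢c))))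
        Y-empty⇒B≐H Y≡∅ (inj₂ j) with j ≟ d
        ... | yes ≡.refl = T⇒≡true d∈B
        ... | no j≢d with T? (B (inj₂ j))
        ...   | yes j∈B = ⊥-elim (Y≡∅ (inj₂ j , ∧-intro j∈B (not-intro (⌊⌋-no (j ≟ d) j≢d))))
        ...   | no j∉B = ¬T⇒≡false j∉B

        Y-nonempty : ¬¬ (∃ λ e → e ∈ Y)
        Y-nonempty = excluded-middle (∃ λ e → e ∈ Y) >>= λ where
          (inj₁ Y≠∅) → return Y≠∅
          (inj₂ Y≡∅) → λ _ → B≢H (Y-empty⇒B≐H Y≡∅)

        |B-columns|≡1+k : count B-columns ≡ suc k
        |B-columns|≡1+k = count-remove B-columns d d∈B

        -- rank A[Y] ≤ k, as a larger independent column set of A[Y] gives m + 1 independent elements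
        rank-Y≤k : ¬ RankAtLeast A Y (suc k)
        rank-Y≤k (D , D⊆Y , |D|≡1+k , ind) =
          ℕP.<-irrefl ≡.refl (≡.subst (_≤ m) size (independent-size≤m A (enumerate (complementRows Y D)) (submatrix⇒independent A Y D ind)))
          where
          size : countG (complementRows Y D) ≡ suc m
          size = ≡.trans (≡.cong₂ ℕ._+_ (≡.trans (count-cong (λ i → de-morgan (B (inj₁ i)) ⌊ i ≟ c ⌋))
                                                  (count-insert B-rows c c∉B)) |D|≡1+k)
                         (≡.trans (≡.cong (λ z → suc (count B-rows ℕ.+ z)) (≡.sym |B-columns|≡1+k)) (≡.cong suc |B|≡m))

        module _ (B'-independent : IndepIA A B') where
          D₀-independent : IndepColsSub A Y D₀
          D₀-independent = independent⇒submatrix A Y D₀ B'-independent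

          rank-Y≥k : RankAtLeast A Y k
          rank-Y≥k = D₀ , (λ j t → t) , ≡.refl , D₀-independent

          rank-X∪Y≥k : RankAtLeast A X∪Y k
          rank-X∪Y≥k = D₀ , (λ j t → ∨-introʳ (pair c d (inj₂ j)) t) , ≡.refl ,
            λ coef outside rel → D₀-independent coef outside (λ i i∈Y → rel i (∨-introʳ (pair c d (inj₁ i)) i∈Y))

          -- k + 1 independent columns of A[X ∪ Y] are exactly B ∩ S₂, which makes B independent
          rank-X∪Y>k⇒B-independent : RankAtLeast A X∪Y (suc k) → IndepIA A B
          rank-X∪Y>k⇒B-independent (D , D⊆X∪Y , |D|≡1+k , ind) =
            independent-⊆ A B⊆complement (submatrix⇒independent A X∪Y B-columns B-columns-independent)
            where
            D⊆B-columns : D ⊆ B-columns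
            D⊆B-columns j j∈D with ∨-elim ⌊ j ≟ d ⌋ (D⊆X∪Y j j∈D)
            ... | inj₁ j≡d = ≡.subst (_∈ B-columns) (≡.sym (toWitness j≡d)) d∈B
            ... | inj₂ j∈D₀ = ∧-elimˡ (B-columns j) j∈D₀
            B-columns-independent : IndepColsSub A X∪Y B-columns
            B-columns-independent coef outside rel j j∈B =
              ind coef (λ j' j'∉D → outside j' (λ j'∈B → j'∉D (B-columns⊆D j' j'∈B))) rel j (B-columns⊆D j j∈B)
              where B-columns⊆D = count-≡⇒⊇ D B-columns D⊆B-columns (≡.trans |D|≡1+k (≡.sym |B-columns|≡1+k))
            B⊆complement : B ⊆ complementRows X∪Y B-columns
            B⊆complement (inj₁ i) i∈B with i ≟ c
            ... | yes ≡.refl = ⊥-elim (c∉B i∈B)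
            ... | no _ rewrite T⇒≡true i∈B = tt
            B⊆complement (inj₂ j) j∈B = j∈B

        exchange : ¬ (det (columnsOf A elem') ≈ 0#) → ¬ (det (columnsOf A elem) ≈ 0#)
        exchange det'≉0 det≈0 = Y-nonempty λ Y≠∅ → excluded-middle (RankAtLeast A X∪Y (suc k)) (by-rank Y≠∅)
          where
          B'-independent : IndepIA A B'
          B'-independent = columnsIndependent⇒independent enumerate-B' A (det≉0⇒independent (columnsOf A elem') det'≉0)
          by-rank : (∃ λ e → e ∈ Y) → RankAtLeast A X∪Y (suc k) ⊎ ¬ RankAtLeast A X∪Y (suc k) → ⊥
          by-rank Y≠∅ (inj₂ rank-X∪Y≯k) = ℕP.<-irrefl ≡.refl
            (proj₂ fragile Y Y≠∅ Y-disjoint k k (rank-X∪Y≥k B'-independent , rank-X∪Y≯k) (rank-Y≥k B'-independent , rank-Y≤k))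
          by-rank Y≠∅ (inj₁ rank-X∪Y>k) = independent⇒det≉0 m (columnsOf A elem)
            (independent⇒columnsIndependent E A (rank-X∪Y>k⇒B-independent B'-independent rank-X∪Y>k)) det≈0

-- A₂ differs from (the image of) A₁ only in the
-- entry (c, d), which becomes x ∉ F; as A₁ c d = 0, column d of A₂ is
-- ι(column d of A₁) + x e_c.  For an m-element set B enumerated as elem,
-- multilinearity gives det A₂[B] = ι α + x ι β with α = det A₁[B] and β the
-- determinant for B - d + c (β = 0 if d ∉ B); since x ∉ ι F this vanishes
-- iff α = β = 0.  The exchange argument turns β ≉ 0, B ≠ H into α ≉ 0, so the
-- bases of M([I, A₂]) are the bases of M([I, A₁]) together with H.
module Relaxation {c₁ ℓ₁ c₂ ℓ₂} (F : Field c₁ ℓ₁) (F' : Field c₂ ℓ₂)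
    (ι : Field.Carrier F → Field.Carrier F')
    (homomorphism : IsRingHomomorphism (Field.rawRing F) (Field.rawRing F') ι)
    {m n} (A₁ : LinAlg.Matrix F m n) (c : Fin m) (d : Fin n)
    (fragile : LinAlg.Fragile F A₁ (pair c d))
    (x : Field.Carrier F') (x∉F : ¬ (∃ λ a → Field._≈_ F' (ι a) x)) where

  module K where
    open Field F public hiding (zero)
    open FieldFacts F public
    open Determinant F public
    open ColumnIndependence F public
    open ColumnMatroid F public
    open BasesOfColumnMatroid F public
  open Field F' hiding (zero)
  open FieldFacts F'
  open Determinant F'
  open ColumnIndependence F'
  open ColumnMatroid F'
  open BasesOfColumnMatroid F'
  open IsRingHomomorphism homomorphism
  open K.Fragile A₁ c d fragile using (H; A[c,d]≈0; module Exchange)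

  A₂ : Matrix m n
  A₂ = replaceEntry ι A₁ c d x

  module M₁ = MatroidNotions {E = Ground m n} _≟G_ (K.IndepIA A₁)
  module M₂ = MatroidNotions {E = Ground m n} _≟G_ (IndepIA A₂)

  ι-∑ : ∀ {k} (f : Fin k → K.Carrier) → ι (K.∑ f) ≈ ∑ (λ i → ι (f i))
  ι-∑ {zero} f = 0#-homo
  ι-∑ {suc k} f = trans (+-homo _ _) (+-congˡ (ι-∑ (λ i → f (suc i))))

  ι-sign : ∀ k → ι (K.sign k) ≈ sign k
  ι-sign zero = 1#-homo
  ι-sign (suc k) = trans (-‿homo _) (-‿cong (ι-sign k))

  ι-det : ∀ {k} (M : K.Matrix k k) → ι (K.det M) ≈ det (λ r c → ι (M r c))
  ι-det {zero} M = 1#-homo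
  ι-det {suc k} M = trans (ι-∑ (K.cofactorTerm M)) (∑-cong term)
    where
    term : ∀ c' → ι (K.cofactorTerm M c') ≈ cofactorTerm (λ r c → ι (M r c)) c'
    term c' = trans (*-homo _ _) (*-cong (trans (*-homo _ _) (*-congʳ (ι-sign (toℕ c')))) (ι-det (K.minor M c')))

  ι-nonzero : ∀ {a} → ¬ (a K.≈ K.0#) → ¬ (ι a ≈ 0#)
  ι-nonzero {a} a≉0 ιa≈0 with K.inverse a a≉0
  ... | (a⁻¹ , aa⁻¹≈1) = 0≉1 (begin
    0#               ≈⟨ sym (zeroˡ (ι a⁻¹)) ⟩
    0# * ι a⁻¹       ≈⟨ *-congʳ (sym ιa≈0) ⟩
    ι a * ι a⁻¹      ≈⟨ sym (*-homo a a⁻¹) ⟩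
    ι (a K.* a⁻¹)    ≈⟨ ⟦⟧-cong aa⁻¹≈1 ⟩
    ι K.1#           ≈⟨ 1#-homo ⟩
    1#               ∎)

  ι-zero : ∀ {a} → a K.≈ K.0# → ι a ≈ 0#
  ι-zero a≈0 = trans (⟦⟧-cong a≈0) 0#-homo

  -- since x ∉ ι F, ι α + x ι β ≉ 0 whenever β ≉ 0
  ι-combination-nonzero : ∀ α β → ¬ (β K.≈ K.0#) → ¬ (ι α + x * ι β ≈ 0#)
  ι-combination-nonzero α β β≉0 combination≈0 with K.inverse β β≉0
  ... | (β⁻¹ , ββ⁻¹≈1) = x∉F (K.- α K.* β⁻¹ , sym x≈) 
    where
    xιβ≈ : x * ι β ≈ - ι α
    xιβ≈ = begin
      x * ι β                  ≈⟨ solve 2 (λ a b → b := (a :+ b) :+ :- a) refl (ι α) (x * ι β) ⟩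
      (ι α + x * ι β) - ι α    ≈⟨ +-congʳ combination≈0 ⟩
      0# - ι α                 ≈⟨ +-identityˡ _ ⟩
      - ι α                    ∎
    x≈ : x ≈ ι (K.- α K.* β⁻¹)
    x≈ = begin
      x                        ≈⟨ sym (*-identityʳ x) ⟩
      x * 1#                   ≈⟨ *-congˡ (sym (trans (sym (*-homo β β⁻¹)) (trans (⟦⟧-cong ββ⁻¹≈1) 1#-homo))) ⟩
      x * (ι β * ι β⁻¹)        ≈⟨ sym (*-assoc _ _ _) ⟩
      (x * ι β) * ι β⁻¹        ≈⟨ *-congʳ xιβ≈ ⟩
      - ι α * ι β⁻¹            ≈⟨ *-congʳ (sym (-‿homo α)) ⟩
      ι (K.- α) * ι β⁻¹        ≈⟨ sym (*-homo _ _) ⟩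
      ι (K.- α K.* β⁻¹)        ∎

  x≉0 : ¬ (x ≈ 0#)
  x≉0 x≈0 = x∉F (K.0# , trans 0#-homo (sym x≈0))

  ι-unitVector : ∀ {k} (i r : Fin k) → ι (K.unitVector i r) ≈ unitVector i r
  ι-unitVector i r with i ≟ r
  ... | yes _ = 1#-homo
  ... | no _ = 0#-homo

  col-A₂ : ∀ e r → e ≢ inj₂ d → col A₂ e r ≈ ι (K.col A₁ e r)
  col-A₂ (inj₁ i) r _ = sym (ι-unitVector i r)
  col-A₂ (inj₂ j) r j≢d with j ≟ d
  ... | yes ≡.refl = ⊥-elim (j≢d ≡.refl)
  ... | no _ with r ≟ c
  ...   | yes _ = refl
  ...   | no _ = refl

  col-A₂-d : ∀ r → col A₂ (inj₂ d) r ≈ 1# * ι (K.col A₁ (inj₂ d) r) + x * unitVector c r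
  col-A₂-d r with r ≟ c | c ≟ r | d ≟ d
  ... | _ | _ | no d≢d = ⊥-elim (d≢d ≡.refl)
  ... | yes ≡.refl | yes _ | yes _ = begin
    x                                ≈⟨ sym (+-identityˡ x) ⟩
    0# + x                           ≈⟨ +-cong (sym (trans (*-identityˡ _) (ι-zero A[c,d]≈0))) (sym (*-identityʳ x)) ⟩
    1# * ι (A₁ r d) + x * 1#         ∎
  ... | yes ≡.refl | no c≢c | yes _ = ⊥-elim (c≢c ≡.refl)
  ... | no r≢c | yes c≡r | yes _ = ⊥-elim (r≢c (≡.sym c≡r))
  ... | no _ | no _ | yes _ = begin
    ι (A₁ r d)                       ≈⟨ sym (+-identityʳ _) ⟩
    ι (A₁ r d) + 0#                  ≈⟨ +-cong (sym (*-identityˡ _)) (sym (zeroʳ x)) ⟩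
    1# * ι (A₁ r d) + x * 0#         ∎

  ι-columnsOf : (Fin m → Ground m n) → Matrix m m
  ι-columnsOf g r k = ι (K.columnsOf A₁ g r k)

  det-A₂-without-d : (g : Fin m → Ground m n) → (∀ a → g a ≢ inj₂ d) →
                     det (columnsOf A₂ g) ≈ ι (K.det (K.columnsOf A₁ g))
  det-A₂-without-d g d∉g = trans (det-cong (λ r a → col-A₂ (g a) r (d∉g a))) (sym (ι-det (K.columnsOf A₁ g)))

  d↦c : (Fin m → Ground m n) → Fin m → Fin m → Ground m n
  d↦c g pos = updateAt g pos (λ _ → inj₁ c)

  det-A₂-with-d : (g : Fin m → Ground m n) (pos : Fin m) → g pos ≡ inj₂ d → (∀ a → a ≢ pos → g a ≢ inj₂ d) →
                  det (columnsOf A₂ g) ≈ ι (K.det (K.columnsOf A₁ g)) + x * ι (K.det (K.columnsOf A₁ (d↦c g pos)))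
  det-A₂-with-d g pos g-pos g-other = begin
    det (columnsOf A₂ g)                                              ≈⟨ det-cong column-d-split ⟩
    det (setCol (ι-columnsOf g) pos v)                                ≈⟨ det-linear (ι-columnsOf g) pos 1# x u (unitVector c) ⟩
    1# * det (setCol (ι-columnsOf g) pos u) + x * det (setCol (ι-columnsOf g) pos (unitVector c))
      ≈⟨ +-cong (trans (*-identityˡ _) (det-cong column-d-kept)) (*-congˡ (det-cong column-d-to-c)) ⟩
    det (ι-columnsOf g) + x * det (ι-columnsOf g')
      ≈⟨ sym (+-cong (ι-det (K.columnsOf A₁ g)) (*-congˡ (ι-det (K.columnsOf A₁ g')))) ⟩
    ι (K.det (K.columnsOf A₁ g)) + x * ι (K.det (K.columnsOf A₁ g'))  ∎
    where
    g' = d↦c g pos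
    u v : Fin m → Carrier
    u r = ι (K.col A₁ (inj₂ d) r)
    v r = 1# * u r + x * unitVector c r
    column-d-split : ∀ r a → columnsOf A₂ g r a ≈ setCol (ι-columnsOf g) pos v r a
    column-d-split r a = case a ≟ pos of λ where
      (yes ≡.refl) → trans (reflexive (≡.cong (λ e → col A₂ e r) g-pos)) (trans (col-A₂-d r) (sym (setCol-≡ (ι-columnsOf g) a v r a ≡.refl)))
      (no a≢pos) → trans (col-A₂ (g a) r (g-other a a≢pos)) (sym (setCol-≢ (ι-columnsOf g) pos v r a a≢pos))
    column-d-kept : ∀ r a → setCol (ι-columnsOf g) pos u r a ≈ ι-columnsOf g r a
    column-d-kept r a = case a ≟ pos of λ where
      (yes ≡.refl) → trans (setCol-≡ (ι-columnsOf g) a u r a ≡.refl) (reflexive (≡.cong (λ e → ι (K.col A₁ e r)) (≡.sym g-pos)))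
      (no a≢pos) → setCol-≢ (ι-columnsOf g) pos u r a a≢pos
    column-d-to-c : ∀ r a → setCol (ι-columnsOf g) pos (unitVector c) r a ≈ ι-columnsOf g' r a
    column-d-to-c r a = case a ≟ pos of λ where
      (yes ≡.refl) → trans (setCol-≡ (ι-columnsOf g) a (unitVector c) r a ≡.refl)
                       (trans (sym (ι-unitVector c r)) (reflexive (≡.cong (λ e → ι (K.col A₁ e r)) (≡.sym (VecFP.updateAt-updates a g)))))
      (no a≢pos) → trans (setCol-≢ (ι-columnsOf g) pos (unitVector c) r a a≢pos)
                     (reflexive (≡.cong (λ e → ι (K.col A₁ e r)) (≡.sym (VecFP.updateAt-minimal a pos g a≢pos))))

  locate-d : ∀ {B : Subset (Ground m n)} (E : Enumeration B m) → let open Enumeration E in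
             (∀ a → elem a ≢ inj₂ d) ⊎ ∃ λ pos → elem pos ≡ inj₂ d × (∀ a → a ≢ pos → elem a ≢ inj₂ d)
  locate-d {B} E with T? (B (inj₂ d))
  ... | no d∉B = inj₁ (outside (inj₂ d) d∉B)
    where open Enumeration E
  ... | yes d∈B with Enumeration.onto E (inj₂ d) d∈B
  ...   | (pos , elem-pos) = inj₂ (pos , elem-pos , λ a a≢pos eq → a≢pos (injective a pos (≡.trans eq (≡.sym elem-pos))))
    where open Enumeration E

  ≐H? : ∀ B → Dec (B ≐ H)
  ≐H? B with FinP.all? (λ i → B (inj₁ i) BoolP.≟ H (inj₁ i)) | FinP.all? (λ j → B (inj₂ j) BoolP.≟ H (inj₂ j))
  ... | yes rows | yes columns = yes λ { (inj₁ i) → rows i ; (inj₂ j) → columns j }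
  ... | no ¬rows | _ = no λ B≐H → ¬rows (λ i → B≐H (inj₁ i))
  ... | _ | no ¬columns = no λ B≐H → ¬columns (λ j → B≐H (inj₂ j))

  -- A basis B ≠ H of M([I, A₂]) is a basis of M([I, A₁]): det A₂[B] ≉ 0 forces α ≉ 0.
  basis₂⇒basis₁ : ∀ B → M₂.IsBasis B → ¬ (B ≐ H) → M₁.IsBasis B
  basis₂⇒basis₁ B basis₂ B≢H =
    K.columnsIndependent⇒independent E A₁ (K.det≉0⇒independent (K.columnsOf A₁ elem) α≉0) , K.size-m⇒maximal A₁ E
    where
    E = enumerate-basis A₂ basis₂
    open Enumeration E
    α = K.det (K.columnsOf A₁ elem)
    D₂≉0 : ¬ (det (columnsOf A₂ elem) ≈ 0#)
    D₂≉0 = independent⇒det≉0 m (columnsOf A₂ elem) (independent⇒columnsIndependent E A₂ (proj₁ basis₂))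
    α≉0-with-d : ∀ pos → elem pos ≡ inj₂ d → (∀ a → a ≢ pos → elem a ≢ inj₂ d) → ¬ (α K.≈ K.0#)
    α≉0-with-d pos elem-pos others α≈0 = case T? (B (inj₁ c)) of λ where
        (yes c∈B) → case onto (inj₁ c) c∈B of λ where
          (pos-c , elem-pos-c) → D₂≈0 (K.det-equal-columns (K.columnsOf A₁ g') pos pos-c (pos≢ pos-c elem-pos-c)
                                         (λ r → K.reflexive (≡.cong (λ e → K.col A₁ e r) (c-twice pos-c elem-pos-c))))
        (no c∉B) → excluded-middle (β K.≈ K.0#) λ where
          (inj₁ β≈0) → D₂≈0 β≈0
          (inj₂ β≉0) → Exchange.exchange B E pos elem-pos c∉B B≢H (basis-size A₂ basis₂) β≉0 α≈0
      where
      g' = d↦c elem pos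
      β = K.det (K.columnsOf A₁ g')
      D₂≈0 : β K.≈ K.0# → ⊥
      D₂≈0 β≈0 = D₂≉0 (begin
        det (columnsOf A₂ elem)  ≈⟨ det-A₂-with-d elem pos elem-pos others ⟩
        ι α + x * ι β            ≈⟨ +-cong (ι-zero α≈0) (*-congˡ (ι-zero β≈0)) ⟩
        0# + x * 0#              ≈⟨ trans (+-identityˡ _) (zeroʳ x) ⟩
        0#                       ∎)
      -- if c ∈ B as well, then c occurs twice in B - d + c
      pos≢ : ∀ pos-c → elem pos-c ≡ inj₁ c → pos ≢ pos-c
      pos≢ pos-c elem-pos-c ≡.refl = case ≡.trans (≡.sym elem-pos) elem-pos-c of λ ()
      c-twice : ∀ pos-c → elem pos-c ≡ inj₁ c → g' pos ≡ g' pos-c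
      c-twice pos-c elem-pos-c = ≡.trans (VecFP.updateAt-updates pos elem)
        (≡.sym (≡.trans (VecFP.updateAt-minimal pos-c pos elem (λ eq → pos≢ pos-c elem-pos-c (≡.sym eq))) elem-pos-c))
    α≉0 : ¬ (α K.≈ K.0#)
    α≉0 α≈0 with locate-d E
    ... | inj₁ d∉B = D₂≉0 (trans (det-A₂-without-d elem d∉B) (ι-zero α≈0))
    ... | inj₂ (pos , elem-pos , others) = α≉0-with-d pos elem-pos others α≈0

  -- A basis of M([I, A₁]) is a basis of M([I, A₂]): α ≉ 0 forces ι α + x ι β ≉ 0.
  basis₁⇒basis₂ : ∀ B → M₁.IsBasis B → M₂.IsBasis B
  basis₁⇒basis₂ B basis₁ =
    columnsIndependent⇒independent E A₂ (det≉0⇒independent (columnsOf A₂ elem) D₂≉0) , size-m⇒maximal A₂ E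
    where
    E = K.enumerate-basis A₁ basis₁
    open Enumeration E
    α = K.det (K.columnsOf A₁ elem)
    α≉0 : ¬ (α K.≈ K.0#)
    α≉0 = K.independent⇒det≉0 m (K.columnsOf A₁ elem) (K.independent⇒columnsIndependent E A₁ (proj₁ basis₁))
    D₂≉0-with-d : ∀ pos → elem pos ≡ inj₂ d → (∀ a → a ≢ pos → elem a ≢ inj₂ d) → ¬ (det (columnsOf A₂ elem) ≈ 0#)
    D₂≉0-with-d pos elem-pos others D₂≈0 = excluded-middle (β K.≈ K.0#) λ where
        (inj₁ β≈0) → ι-nonzero α≉0 (begin
          ι α                      ≈⟨ sym (+-identityʳ _) ⟩
          ι α + 0#                 ≈⟨ +-congˡ (sym (trans (*-congˡ (ι-zero β≈0)) (zeroʳ x))) ⟩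
          ι α + x * ι β            ≈⟨ sym expansion ⟩
          det (columnsOf A₂ elem)  ≈⟨ D₂≈0 ⟩
          0#                       ∎)
        (inj₂ β≉0) → ι-combination-nonzero α β β≉0 (trans (sym expansion) D₂≈0)
      where
      β = K.det (K.columnsOf A₁ (d↦c elem pos))
      expansion = det-A₂-with-d elem pos elem-pos others
    D₂≉0 : ¬ (det (columnsOf A₂ elem) ≈ 0#)
    D₂≉0 D₂≈0 with locate-d E
    ... | inj₁ d∉B = ι-nonzero α≉0 (trans (sym (det-A₂-without-d elem d∉B)) D₂≈0)
    ... | inj₂ (pos , elem-pos , others) = D₂≉0-with-d pos elem-pos others D₂≈0

  -- H is a basis of M([I, A₂]), as A₂ c d = x ≉ 0
  H-basis₂ : ∀ B → B ≐ H → M₂.IsBasis B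
  H-basis₂ B B≐H = independent-⊆ A₂ (λ e e∈B → ≡.subst T (B≐H e) e∈B) (hyp-independent A₂ c d A₂[c,d]≉0) , maximal
    where
    A₂[c,d]≉0 : ¬ (A₂ c d ≈ 0#)
    A₂[c,d]≉0 with c ≟ c | d ≟ d
    ... | yes _ | yes _ = x≉0
    ... | no c≢c | _ = ⊥-elim (c≢c ≡.refl)
    ... | yes _ | no d≢d = ⊥-elim (d≢d ≡.refl)
    maximal : ∀ e → ¬ e ∈ B → ¬ IndepIA A₂ (insertG e B)
    maximal e e∉B ind = size-m⇒maximal A₂ (enumerateHyp c d) e (λ e∈H → e∉B (≡.subst T (≡.sym (B≐H e)) e∈H))
      (independent-⊆ A₂ (λ y t → ≡.subst (λ b → T (⌊ y ≟G e ⌋ ∨ b)) (≡.sym (B≐H y)) t) ind)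

  relaxation : IsRelaxation _≟G_ (K.IndepIA A₁) (IndepIA A₂) H
  relaxation B = forward , backward
    where
    forward : M₂.IsBasis B → M₁.IsBasis B ⊎ B ≐ H
    forward basis₂ with ≐H? B
    ... | yes B≐H = inj₂ B≐H
    ... | no B≢H = inj₁ (basis₂⇒basis₁ B basis₂ B≢H)
    backward : M₁.IsBasis B ⊎ B ≐ H → M₂.IsBasis B
    backward (inj₁ basis₁) = basis₁⇒basis₂ B basis₁
    backward (inj₂ B≐H) = H-basis₂ B B≐H

lemma4p1 : ∀ {c₁ ℓ₁ c₂ ℓ₂} (F : Field c₁ ℓ₁) (F' : Field c₂ ℓ₂)
    (ι : Field.Carrier F → Field.Carrier F') →
    IsRingHomomorphism (Field.rawRing F) (Field.rawRing F') ι →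
    ∀ {m n} (A₁ : LinAlg.Matrix F m n) (c : Fin m) (d : Fin n) →
    LinAlg.Fragile F A₁ (pair c d) →
    (x : Field.Carrier F') → ¬ (∃ λ a → Field._≈_ F' (ι a) x) →
    MatroidNotions.IsCircuitHyperplane _≟G_ (LinAlg.IndepIA F A₁) (hyp c d)
    × IsRelaxation _≟G_ (LinAlg.IndepIA F A₁)
    (LinAlg.IndepIA F' (replaceEntry ι A₁ c d x)) (hyp c d)
lemma4p1 F F' ι homomorphism A₁ c d fragile x x∉F = circuit-hyperplane , relaxation
  where
  circuit-hyperplane : MatroidNotions.IsCircuitHyperplane _≟G_ (LinAlg.IndepIA F A₁) (hyp c d)
  circuit-hyperplane = BasesOfColumnMatroid.Fragile.H-circuit-hyperplane F A₁ c d fragile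
  open Relaxation F F' ι homomorphism A₁ c d fragile x x∉F using (relaxation)
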